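{- Let $G$ be a finite simple $3$-regular circle graph which is not isomorphic to $K_4$ or $K_{3,3}$. Then $G$ is not $3$-connected.
   Context: All graphs are finite and simple. A double occurrence word is a finite sequence in which each letter that appears, appears exactly twice. The interlacement graph $\mathcal{I}(W)$ has one vertex per letter, with $a,b$ adjacent iff the letters appear in the order $abab$ or $baba$ in $W$. A circle graph is a simple graph isomorphic to some $\mathcal{I}(W)$. -}

module Defs where

open import Data.Nat using (ℕ; _<_; _<ᵇ_)
open import Data.Fin using (Fin; toℕ; _≟_)
open import Data.Fin.Properties using ()
open import Data.List using (List; []; _∷_; length; filter; allFin)
open import Data.List.Membership.Propositional using (_∈_; _∉_)
open import Data.List.Relation.Binary.Sublist.Propositional using (_⊆_)
open import Data.Product using (Σ; ∃; _×_)
open import Data.Sum using (_⊎_)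
open import Data.Bool using (Bool; true; false)
open import Function.Bundles using (_↔_; _⇔_; Inverse)
open import Relation.Nullary using (¬_)
open import Relation.Binary using (Decidable)
open import Relation.Binary.PropositionalEquality using (_≡_; _≢_)
open import Level using (0ℓ) renaming (suc to lsuc)

record Graph (n : ℕ) : Set₁ where
  field
    E       : Fin n → Fin n → Set
    E-dec   : Decidable E
    E-sym   : ∀ {u v} → E u v → E v u
    E-irrefl : ∀ {u} → ¬ E u u
open Graph public

degree : ∀ {n} → Graph n → Fin n → ℕ
degree G v = length (filter (E-dec G v) (allFin _))

Regular : ∀ {n} → ℕ → Graph n → Set
Regular k G = ∀ v → degree G v ≡ k

IsoTo : ∀ {n} → Graph n → (k : ℕ) → (Fin k → Fin k → Set) → Set
IsoTo {n} G k R =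
  Σ (Fin n ↔ Fin k) λ f →
    ∀ u v → E G u v ⇔ R (Inverse.to f u) (Inverse.to f v)

K4-adj : Fin 4 → Fin 4 → Set
K4-adj u v = u ≢ v

side : Fin 6 → Bool
side u = toℕ u <ᵇ 3

K33-adj : Fin 6 → Fin 6 → Set
K33-adj u v = side u ≢ side v

DoubleOccurrence : ∀ {m} → List (Fin m) → Set
DoubleOccurrence {m} W = ∀ (a : Fin m) → length (filter (_≟ a) W) ≡ 2

Interlaced : ∀ {m} → List (Fin m) → Fin m → Fin m → Set
Interlaced W a b =
  (a ∷ b ∷ a ∷ b ∷ []) ⊆ W ⊎ (b ∷ a ∷ b ∷ a ∷ []) ⊆ W

CircleGraph : ∀ {n} → Graph n → Set
CircleGraph G =
  ∃ λ (m : ℕ) → ∃ λ (W : List (Fin m)) →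
    DoubleOccurrence W × IsoTo G m (Interlaced W)

data Reach {n} (G : Graph n) (S : List (Fin n)) : Fin n → Fin n → Set where
  here : ∀ {u} → Reach G S u u
  step : ∀ {u w v} → E G u w → w ∉ S → Reach G S w v → Reach G S u v

Connected-k : ∀ {n} → ℕ → Graph n → Set
Connected-k {n} k G =
  k < n ×
  (∀ (S : List (Fin n)) → length S < k →
     ∀ u v → u ∉ S → v ∉ S → Reach G S u v)

module Submission where

-- A circle graph is the interlacement graph of a cyclic double occurrence word, read here as a
-- periodic sequence f of period L = 2n in which a letter is adjacent to exactly the letters
-- occurring once strictly inside the chord between its two occurrences. If G is 3-regular, every
-- chord has at least three letters inside; if G is 3-connected, no window can contain one letter
-- twice, miss another one, and contain at most two letters once, since those two would separate G.
-- Starting from a shortest chord (three letters inside), these two facts force, up to rotation,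
-- f (3 j) = f (3 j + 4) for all j. Then 3 divides L, the letters at positions 2 (mod 3) are paired
-- among themselves, and the same two facts force L = 12 and the word 0 3 4 5 0 2 1 5 4 3 1 2, whose
-- interlacement graph is K₃,₃. For n = 4 the only 3-regular graph is K₄.

open import Data.Nat using (ℕ; zero; suc; _+_; _*_; _∸_; _≤_; _<_; z≤n; s≤s; s≤s⁻¹; _≟_; _≤?_; _<?_)
open import Data.Nat.Properties
open import Data.Nat.DivMod using (_%_; _/_; m≡m%n+[m/n]*n; [m+n]%n≡m%n; [m+kn]%n≡m%n; m<n⇒m%n≡m; m%n<n)
open import Data.Nat.Tactic.RingSolver using (solve-∀)
open import Data.Fin using (Fin; zero; suc; fromℕ<) renaming (_≟_ to _≟F_)
open import Data.Fin.Patterns using (0F; 1F; 2F; 3F; 4F; 5F)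
import Data.Fin.Properties as Fin
open import Data.Fin.Properties using (any?; all?)
open import Data.List using (List; []; _∷_; length; filter; allFin; tabulate; drop)
open import Data.List.Membership.Propositional using (_∉_)
open import Data.List.Membership.Propositional.Properties using (∈-filter⁺; ∈-filter⁻; ∈-allFin)
open import Data.Product using (∃; ∃₂; _×_; _,_; proj₁; proj₂)
open import Data.Sum using (_⊎_; inj₁; inj₂)
import Data.Bool.Properties as Bool
open import Data.Empty using (⊥; ⊥-elim)
open import Data.Unit using (tt)
open import Relation.Nullary using (¬_; Dec; yes; no; does; ¬?)
open import Relation.Nullary.Negation using (¬∃⟶∀¬)
open import Relation.Nullary.Decidable using (toWitness)
open import Relation.Unary using (Pred; Decidable)
open import Relation.Binary.PropositionalEquality
open import Relation.Binary.Definitions using (tri<; tri≈; tri>)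
open import Function.Base using (_∘_)
open import Function.Construct.Composition using (_⇔-∘_)
open import Function.Bundles using (_⇔_; mk⇔; Equivalence; _↔_; mk↔ₛ′; Inverse)
open import Defs

infixr 5 _∙_
_∙_ : ∀ {a} {A : Set a} {x y z : A} → x ≡ y → y ≡ z → x ≡ z
_∙_ = trans

x+y+w≡2⇒y≡1 : ∀ x y w → 1 ≤ x → 1 ≤ y → x + y + w ≡ 2 → y ≡ 1
x+y+w≡2⇒y≡1 (suc zero) (suc zero) w _ _ _ = refl
x+y+w≡2⇒y≡1 (suc zero) (suc (suc y)) w _ _ ()
x+y+w≡2⇒y≡1 (suc (suc x)) (suc y) w _ _ e with trans (sym (cong (_+ w) (+-suc x y))) (suc-injective (suc-injective e))
... | ()

x+y≡2⇒x≡1 : ∀ x y → 1 ≤ x → 1 ≤ y → x + y ≡ 2 → x ≡ 1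
x+y≡2⇒x≡1 x y hx hy e = x+y+w≡2⇒y≡1 y x 0 hy hx (+-identityʳ _ ∙ +-comm y x ∙ e)

residue-mod3-unique : ∀ x y r q → r < 3 → q < 3 → 3 * x + r ≡ 3 * y + q → r ≡ q
residue-mod3-unique x y r q r<3 q<3 e =
  sym (m<n⇒m%n≡m r<3) ∙ sym ([m+kn]%n≡m%n r x 3)
  ∙ cong (_% 3) (swap x r ∙ e ∙ sym (swap y q))
  ∙ [m+kn]%n≡m%n q y 3 ∙ m<n⇒m%n≡m q<3
  where
  swap : ∀ x r → r + x * 3 ≡ 3 * x + r
  swap = solve-∀

complement-once⇔once : ∀ Y X A c → Y + c + X + c + A ≡ 2 → c ≤ 1 → (A + Y ≡ 1 ⇔ X ≡ 1)
complement-once⇔once Y X A zero e _ =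
  mk⇔ (λ h → suc-injective (+-comm 1 X ∙ cong (X +_) (sym h) ∙ total))
      (λ h → suc-injective (+-comm 1 (A + Y) ∙ cong ((A + Y) +_) (sym h) ∙ +-comm (A + Y) X ∙ total))
  where
  total : X + (A + Y) ≡ 2
  total = regroup Y X A ∙ e
    where regroup : ∀ Y X A → X + (A + Y) ≡ Y + 0 + X + 0 + A
          regroup = solve-∀
complement-once⇔once Y X A (suc zero) e _ =
  mk⇔ (λ h → ⊥-elim (0≢1+n (sym (m+n≡0⇒n≡0 X rest) ∙ h))) (λ h → ⊥-elim (0≢1+n (sym (m+n≡0⇒m≡0 X rest) ∙ h)))
  where
  rest : X + (A + Y) ≡ 0
  rest = suc-injective (suc-injective (regroup Y X A ∙ e))
    where regroup : ∀ Y X A → suc (suc (X + (A + Y))) ≡ Y + 1 + X + 1 + A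
          regroup = solve-∀
complement-once⇔once Y X A (suc (suc c)) e (s≤s ())

divmod3 : ∀ p → ∃ λ t → p ≡ 3 * t ⊎ p ≡ 3 * t + 1 ⊎ p ≡ 3 * t + 2
divmod3 zero = 0 , inj₁ refl
divmod3 (suc zero) = 0 , inj₂ (inj₁ refl)
divmod3 (suc (suc zero)) = 0 , inj₂ (inj₂ refl)
divmod3 (suc (suc (suc p))) with divmod3 p
... | t , inj₁ e = suc t , inj₁ (cong (3 +_) e ∙ ar t)
  where ar : ∀ t → 3 + 3 * t ≡ 3 * suc t
        ar = solve-∀
... | t , inj₂ (inj₁ e) = suc t , inj₂ (inj₁ (cong (3 +_) e ∙ ar t))
  where ar : ∀ t → 3 + (3 * t + 1) ≡ 3 * suc t + 1
        ar = solve-∀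
... | t , inj₂ (inj₂ e) = suc t , inj₂ (inj₂ (cong (3 +_) e ∙ ar t))
  where ar : ∀ t → 3 + (3 * t + 2) ≡ 3 * suc t + 2
        ar = solve-∀

∸-< : ∀ {m n L} → n ≤ m → m < n + L → m ∸ n < L
∸-< {m} {n} {L} n≤m lt = +-cancelˡ-< n (m ∸ n) L (subst (_< n + L) (sym (m+[n∸m]≡n n≤m)) lt)

1≤∧≱2⇒≡1 : ∀ x → 1 ≤ x → ¬ (2 ≤ x) → x ≡ 1
1≤∧≱2⇒≡1 (suc zero) _ _ = refl
1≤∧≱2⇒≡1 (suc (suc x)) _ h = ⊥-elim (h (s≤s (s≤s z≤n)))

≤⇒+ : ∀ {m n} → m ≤ n → ∃ λ r → n ≡ m + r
≤⇒+ {m} {n} h = n ∸ m , sym (m+[n∸m]≡n h)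

𝟙 : ∀ {ℓ} {P : Set ℓ} → Dec P → ℕ
𝟙 (yes _) = 1
𝟙 (no _) = 0

𝟙-yes : ∀ {ℓ} {P : Set ℓ} (d : Dec P) → P → 𝟙 d ≡ 1
𝟙-yes (yes _) _ = refl
𝟙-yes (no ¬p) p = ⊥-elim (¬p p)

𝟙-no : ∀ {ℓ} {P : Set ℓ} (d : Dec P) → ¬ P → 𝟙 d ≡ 0
𝟙-no (yes p) ¬p = ⊥-elim (¬p p)
𝟙-no (no _) _ = refl

𝟙≤1 : ∀ {ℓ} {P : Set ℓ} (d : Dec P) → 𝟙 d ≤ 1
𝟙≤1 (yes _) = s≤s z≤n
𝟙≤1 (no _) = z≤n

𝟙-cong : ∀ {ℓ ℓ'} {P : Set ℓ} {Q : Set ℓ'} (d : Dec P) (e : Dec Q) → (P → Q) → (Q → P) → 𝟙 d ≡ 𝟙 e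
𝟙-cong (yes _) (yes _) _ _ = refl
𝟙-cong (yes p) (no ¬q) pq _ = ⊥-elim (¬q (pq p))
𝟙-cong (no ¬p) (yes q) _ qp = ⊥-elim (¬p (qp q))
𝟙-cong (no _) (no _) _ _ = refl

Dec-⇔ : ∀ {a b} {P : Set a} {Q : Set b} (p : Dec P) (q : Dec Q) → does p ≡ does q → P ⇔ Q
Dec-⇔ (yes p) (yes q) _ = mk⇔ (λ _ → q) (λ _ → p)
Dec-⇔ (no ¬p) (no ¬q) _ = mk⇔ (⊥-elim ∘ ¬p) (⊥-elim ∘ ¬q)

∑ : ∀ {n} → (Fin n → ℕ) → ℕ
∑ {zero} g = 0
∑ {suc n} g = g zero + ∑ (λ i → g (suc i))

∑-cong : ∀ {n} {g h : Fin n → ℕ} → (∀ i → g i ≡ h i) → ∑ g ≡ ∑ h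
∑-cong {zero} e = refl
∑-cong {suc n} e = cong₂ _+_ (e zero) (∑-cong (λ i → e (suc i)))

∑-mono-≤ : ∀ {n} {g h : Fin n → ℕ} → (∀ i → g i ≤ h i) → ∑ g ≤ ∑ h
∑-mono-≤ {zero} e = z≤n
∑-mono-≤ {suc n} e = +-mono-≤ (e zero) (∑-mono-≤ (λ i → e (suc i)))

∑-+ : ∀ {n} (g h : Fin n → ℕ) → ∑ (λ i → g i + h i) ≡ ∑ g + ∑ h
∑-+ {zero} g h = refl
∑-+ {suc n} g h rewrite ∑-+ (λ i → g (suc i)) (λ i → h (suc i)) = interchange (g zero) (h zero) _ _
  where
  interchange : ∀ a b c d → a + b + (c + d) ≡ a + c + (b + d)
  interchange = solve-∀

∑-const : ∀ n (c : ℕ) → ∑ {n} (λ _ → c) ≡ n * c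
∑-const zero c = refl
∑-const (suc n) c = cong (c +_) (∑-const n c)

∑-𝟙-singleton : ∀ {n} (x : Fin n) → ∑ (λ i → 𝟙 (x ≟F i)) ≡ 1
∑-𝟙-singleton {suc n} zero =
  cong suc (∑-cong {n} {g = λ i → 𝟙 (zero ≟F suc i)} (λ i → 𝟙-no (zero ≟F suc i) (λ ())) ∙ ∑-const n 0 ∙ *-zeroʳ n)
∑-𝟙-singleton {suc n} (suc x) =
  ∑-cong (λ i → 𝟙-cong (suc x ≟F suc i) (x ≟F i) Fin.suc-injective (cong suc)) ∙ ∑-𝟙-singleton x

length-filter-tabulate : ∀ {n m} {p} {P : Pred (Fin n) p} (P? : Decidable P) (h : Fin m → Fin n) →
  length (filter P? (tabulate h)) ≡ ∑ (λ i → 𝟙 (P? (h i)))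
length-filter-tabulate {m = zero} P? h = refl
length-filter-tabulate {m = suc m} P? h with P? (h zero)
... | yes _ = cong suc (length-filter-tabulate P? (λ i → h (suc i)))
... | no _ = length-filter-tabulate P? (λ i → h (suc i))

length-filter-allFin : ∀ {n} {p} {P : Pred (Fin n) p} (P? : Decidable P) →
  length (filter P? (allFin n)) ≡ ∑ (λ i → 𝟙 (P? i))
length-filter-allFin P? = length-filter-tabulate P? (λ i → i)

#ones : ∀ {n} → (Fin n → ℕ) → ℕ
#ones g = ∑ (λ i → 𝟙 (g i ≟ 1))

∑≡#ones : ∀ {n} (g : Fin n → ℕ) → (∀ i → g i ≤ 1) → ∑ g ≡ #ones g
∑≡#ones g h = ∑-cong (λ i → pointwise (g i) (h i))
  where
  pointwise : ∀ x → x ≤ 1 → x ≡ 𝟙 (x ≟ 1)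
  pointwise zero _ = refl
  pointwise (suc zero) _ = refl
  pointwise (suc (suc x)) (s≤s ())

#ones≤∑ : ∀ {n} (g : Fin n → ℕ) → #ones g ≤ ∑ g
#ones≤∑ g = ∑-mono-≤ (λ i → pointwise (g i))
  where
  pointwise : ∀ x → 𝟙 (x ≟ 1) ≤ x
  pointwise zero = z≤n
  pointwise (suc zero) = s≤s z≤n
  pointwise (suc (suc x)) = z≤n

module _ {n} {p} {P : Pred (Fin n) p} (P? : Decidable P) where

  # : ℕ
  # = ∑ (λ z → 𝟙 (P? z))

  four-distinct⇒4≤# : ∀ a b c d → P a → P b → P c → P d →
    a ≢ b → a ≢ c → a ≢ d → b ≢ c → b ≢ d → c ≢ d → 4 ≤ #
  four-distinct⇒4≤# a b c d pa pb pc pd ab ac ad bc bd cd = subst (_≤ #) four (∑-mono-≤ pointwise)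
    where
    four : ∑ (λ z → 𝟙 (a ≟F z) + 𝟙 (b ≟F z) + 𝟙 (c ≟F z) + 𝟙 (d ≟F z)) ≡ 4
    four =
      ∑-+ (λ z → 𝟙 (a ≟F z) + 𝟙 (b ≟F z) + 𝟙 (c ≟F z)) (λ z → 𝟙 (d ≟F z))
      ∙ cong₂ _+_ (∑-+ (λ z → 𝟙 (a ≟F z) + 𝟙 (b ≟F z)) (λ z → 𝟙 (c ≟F z))
                   ∙ cong₂ _+_ (∑-+ (λ z → 𝟙 (a ≟F z)) (λ z → 𝟙 (b ≟F z))
                                ∙ cong₂ _+_ (∑-𝟙-singleton a) (∑-𝟙-singleton b))
                               (∑-𝟙-singleton c))
                  (∑-𝟙-singleton d)
    pointwise : ∀ z → 𝟙 (a ≟F z) + 𝟙 (b ≟F z) + 𝟙 (c ≟F z) + 𝟙 (d ≟F z) ≤ 𝟙 (P? z)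
    pointwise z with a ≟F z | b ≟F z | c ≟F z | d ≟F z
    ... | yes e1 | yes e | _ | _ = ⊥-elim (ab (e1 ∙ sym e))
    ... | yes e1 | no _ | yes e | _ = ⊥-elim (ac (e1 ∙ sym e))
    ... | yes e1 | no _ | no _ | yes e = ⊥-elim (ad (e1 ∙ sym e))
    ... | yes e1 | no _ | no _ | no _ = ≤-reflexive (sym (𝟙-yes (P? z) (subst P e1 pa)))
    ... | no _ | yes e1 | yes e | _ = ⊥-elim (bc (e1 ∙ sym e))
    ... | no _ | yes e1 | no _ | yes e = ⊥-elim (bd (e1 ∙ sym e))
    ... | no _ | yes e1 | no _ | no _ = ≤-reflexive (sym (𝟙-yes (P? z) (subst P e1 pb)))
    ... | no _ | no _ | yes e1 | yes e = ⊥-elim (cd (e1 ∙ sym e))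
    ... | no _ | no _ | yes e1 | no _ = ≤-reflexive (sym (𝟙-yes (P? z) (subst P e1 pc)))
    ... | no _ | no _ | no _ | yes e1 = ≤-reflexive (sym (𝟙-yes (P? z) (subst P e1 pd)))
    ... | no _ | no _ | no _ | no _ = z≤n

  #≡3⇒one-of-three : # ≡ 3 → ∀ a b c → P a → P b → P c → a ≢ b → a ≢ c → b ≢ c →
    ∀ z → P z → z ≡ a ⊎ z ≡ b ⊎ z ≡ c
  #≡3⇒one-of-three h a b c pa pb pc ab ac bc z pz with z ≟F a | z ≟F b | z ≟F c
  ... | yes e | _ | _ = inj₁ e
  ... | no _ | yes e | _ = inj₂ (inj₁ e)
  ... | no _ | no _ | yes e = inj₂ (inj₂ e)
  ... | no za | no zb | no zc
    with ≤-trans (four-distinct⇒4≤# a b c z pa pb pc pz ab ac (za ∘ sym) bc (zb ∘ sym) (zc ∘ sym)) (≤-reflexive h)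
  ... | s≤s (s≤s (s≤s ()))

  one-of-two⇒#≤2 : ∀ a b → (∀ z → P z → z ≡ a ⊎ z ≡ b) → # ≤ 2
  one-of-two⇒#≤2 a b h =
    ≤-trans (∑-mono-≤ pointwise)
            (≤-reflexive (∑-+ (λ z → 𝟙 (a ≟F z)) (λ z → 𝟙 (b ≟F z)) ∙ cong₂ _+_ (∑-𝟙-singleton a) (∑-𝟙-singleton b)))
    where
    pointwise : ∀ z → 𝟙 (P? z) ≤ 𝟙 (a ≟F z) + 𝟙 (b ≟F z)
    pointwise z with P? z
    ... | no _ = z≤n
    ... | yes pz with h z pz
    ...   | inj₁ e = ≤-trans (≤-reflexive (sym (𝟙-yes (a ≟F z) (sym e)))) (m≤m+n _ _)
    ...   | inj₂ e = ≤-trans (≤-reflexive (sym (𝟙-yes (b ≟F z) (sym e)))) (m≤n+m _ _)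

-- Letter counts in windows of a sequence

count : ∀ {n} → (ℕ → Fin n) → Fin n → ℕ → ℕ → ℕ
count f v a zero = 0
count f v a (suc k) = 𝟙 (f a ≟F v) + count f v (suc a) k

module _ {n} (f : ℕ → Fin n) where

  count-+ : ∀ v a k l → count f v a (k + l) ≡ count f v a k + count f v (a + k) l
  count-+ v a zero l = cong (λ x → count f v x l) (sym (+-identityʳ a))
  count-+ v a (suc k) l rewrite count-+ v (suc a) k l | +-suc a k = sym (+-assoc (𝟙 (f a ≟F v)) _ _)

  count≤ : ∀ v a k → count f v a k ≤ k
  count≤ v a zero = z≤n
  count≤ v a (suc k) = +-mono-≤ (𝟙≤1 (f a ≟F v)) (count≤ v (suc a) k)

  hit⇒1≤count : ∀ v a k i → i < k → f (a + i) ≡ v → 1 ≤ count f v a k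
  hit⇒1≤count v a (suc k) zero _ e = ≤-trans (≤-reflexive (sym (𝟙-yes (f a ≟F v) (trans (cong f (sym (+-identityʳ a))) e)))) (m≤m+n _ _)
  hit⇒1≤count v a (suc k) (suc i) (s≤s i<k) e = ≤-trans (hit⇒1≤count v (suc a) k i i<k (trans (cong f (sym (+-suc a i))) e)) (m≤n+m _ _)

  1≤count⇒hit : ∀ v a k → 1 ≤ count f v a k → ∃ λ i → i < k × f (a + i) ≡ v
  1≤count⇒hit v a zero ()
  1≤count⇒hit v a (suc k) h with f a ≟F v
  ... | yes e = 0 , s≤s z≤n , trans (cong f (+-identityʳ a)) e
  ... | no _ with 1≤count⇒hit v (suc a) k h
  ... | i , i<k , e = suc i , s≤s i<k , trans (cong f (+-suc a i)) e

  2≤count⇒hit₂ : ∀ v a k → 2 ≤ count f v a k → ∃₂ λ i j → i < j × j < k × f (a + i) ≡ v × f (a + j) ≡ v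
  2≤count⇒hit₂ v a zero ()
  2≤count⇒hit₂ v a (suc k) h with f a ≟F v
  ... | yes e with 1≤count⇒hit v (suc a) k (s≤s⁻¹ h)
  ...   | j , j<k , e' = 0 , suc j , s≤s z≤n , s≤s j<k , trans (cong f (+-identityʳ a)) e , trans (cong f (+-suc a j)) e'
  2≤count⇒hit₂ v a (suc k) h | no _ with 2≤count⇒hit₂ v (suc a) k h
  ... | i , j , i<j , j<k , e1 , e2 = suc i , suc j , s≤s i<j , s≤s j<k , trans (cong f (+-suc a i)) e1 , trans (cong f (+-suc a j)) e2

  hit₂⇒2≤count : ∀ v a k i j → i < j → j < k → f (a + i) ≡ v → f (a + j) ≡ v → 2 ≤ count f v a k
  hit₂⇒2≤count v a k i j i<j j<k e1 e2 =
    let s = suc i in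
    let eqk : s + (k ∸ s) ≡ k
        eqk = m+[n∸m]≡n (≤-trans i<j (<⇒≤ j<k)) in
    let h1 = hit⇒1≤count v a s i ≤-refl e1 in
    let h2 = hit⇒1≤count v (a + s) (k ∸ s) (j ∸ s)
               (∸-monoˡ-< j<k i<j)
               (trans (cong f (trans (+-assoc a s (j ∸ s)) (cong (a +_) (m+[n∸m]≡n i<j)))) e2) in
    subst (2 ≤_) (trans (sym (count-+ v a s (k ∸ s))) (cong (count f v a) eqk)) (+-mono-≤ h1 h2)

  hit₃⇒3≤count : ∀ v a k i j l → i < j → j < l → l < k → f (a + i) ≡ v → f (a + j) ≡ v → f (a + l) ≡ v → 3 ≤ count f v a k
  hit₃⇒3≤count v a k i j l i<j j<l l<k e1 e2 e3 =
    let s = suc i in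
    let i<k = ≤-trans i<j (<⇒≤ (≤-trans j<l (<⇒≤ l<k))) in
    let eqk : s + (k ∸ s) ≡ k
        eqk = m+[n∸m]≡n i<k in
    let h1 = hit⇒1≤count v a s i ≤-refl e1 in
    let fix : ∀ x → s ≤ x → f (a + s + (x ∸ s)) ≡ f (a + x)
        fix x h = cong f (trans (+-assoc a s (x ∸ s)) (cong (a +_) (m+[n∸m]≡n h))) in
    let h2 = hit₂⇒2≤count v (a + s) (k ∸ s) (j ∸ s) (l ∸ s)
               (∸-monoˡ-< j<l i<j) (∸-monoˡ-< l<k (≤-trans i<j (<⇒≤ j<l)))
               (trans (fix j i<j) e2) (trans (fix l (≤-trans i<j (<⇒≤ j<l))) e3) in
    subst (3 ≤_) (trans (sym (count-+ v a s (k ∸ s))) (cong (count f v a) eqk)) (+-mono-≤ h1 h2)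

  count≤2⇒no-third-hit : ∀ {v} a k → count f v a k ≤ 2 → ∀ {i j l} → i < j → j < l → l < k →
    f (a + i) ≡ v → f (a + j) ≡ v → f (a + l) ≡ v → ⊥
  count≤2⇒no-third-hit a k c≤2 i<j j<l l<k ei ej el =
    <-irrefl refl (≤-trans (hit₃⇒3≤count _ a k _ _ _ i<j j<l l<k ei ej el) c≤2)

  count≤2⇒hit-is-one-of : ∀ {v} a k → count f v a k ≤ 2 → ∀ {i j l} → i < j → j < k → l < k →
    f (a + i) ≡ v → f (a + j) ≡ v → f (a + l) ≡ v → l ≡ i ⊎ l ≡ j
  count≤2⇒hit-is-one-of a k c≤2 {i} {j} {l} i<j j<k l<k ei ej el with <-cmp l i
  ... | tri< l<i _ _ = ⊥-elim (count≤2⇒no-third-hit a k c≤2 l<i i<j j<k el ei ej)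
  ... | tri≈ _ l≡i _ = inj₁ l≡i
  ... | tri> _ _ i<l with <-cmp l j
  ...   | tri< l<j _ _ = ⊥-elim (count≤2⇒no-third-hit a k c≤2 i<l l<j j<k ei el ej)
  ...   | tri≈ _ l≡j _ = inj₂ l≡j
  ...   | tri> _ _ j<l = ⊥-elim (count≤2⇒no-third-hit a k c≤2 i<j j<l l<k ei ej el)

  ∑-count : ∀ a k → ∑ (λ v → count f v a k) ≡ k
  ∑-count a zero = ∑-const n 0 ∙ *-zeroʳ n
  ∑-count a (suc k) = ∑-+ (λ v → 𝟙 (f a ≟F v)) (λ v → count f v (suc a) k) ∙ cong₂ _+_ (∑-𝟙-singleton (f a)) (∑-count (suc a) k)

  #once : ℕ → ℕ → ℕ
  #once a k = #ones (λ v → count f v a k)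

  #once≤length : ∀ a k → #once a k ≤ k
  #once≤length a k = ≤-trans (#ones≤∑ (λ v → count f v a k)) (≤-reflexive (∑-count a k))

  no-double⇒length≡#once : ∀ a k → (∀ v → ¬ 2 ≤ count f v a k) → k ≡ #once a k
  no-double⇒length≡#once a k h = sym (∑-count a k) ∙ ∑≡#ones (λ v → count f v a k) (λ v → ≤-pred (≰⇒> (h v)))

count-shift : ∀ {n} (f : ℕ → Fin n) w v a k → count (λ p → f (w + p)) v a k ≡ count f v (w + a) k
count-shift f w v a zero = refl
count-shift f w v a (suc k) = cong₂ _+_ refl (count-shift f w v (suc a) k ∙ cong (λ x → count f v x k) (+-suc w a))

count-relabel : ∀ {n m} (f : ℕ → Fin n) (g : ℕ → Fin m) v w → (∀ p → f p ≡ v → g p ≡ w) → (∀ p → g p ≡ w → f p ≡ v) →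
  ∀ a k → count f v a k ≡ count g w a k
count-relabel f g v w h1 h2 a zero = refl
count-relabel f g v w h1 h2 a (suc k) = cong₂ _+_ (𝟙-cong (f a ≟F v) (g a ≟F w) (h1 a) (h2 a)) (count-relabel f g v w h1 h2 (suc a) k)

count-cong : ∀ {n} (f g : ℕ → Fin n) v a k → (∀ i → i < k → f (a + i) ≡ g (a + i)) → count f v a k ≡ count g v a k
count-cong f g v a zero h = refl
count-cong f g v a (suc k) h =
  cong₂ _+_ (cong (λ x → 𝟙 (x ≟F v)) (cong f (sym (+-identityʳ a)) ∙ h 0 (s≤s z≤n) ∙ cong g (+-identityʳ a)))
            (count-cong f g v (suc a) k (λ i i<k → cong f (sym (+-suc a i)) ∙ h (suc i) (s≤s i<k) ∙ cong g (+-suc a i)))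

count-+period : ∀ {n} (f : ℕ → Fin n) L → (∀ p → f (p + L) ≡ f p) → ∀ v a k → count f v (a + L) k ≡ count f v a k
count-+period f L periodic v a zero = refl
count-+period f L periodic v a (suc k) = cong₂ _+_ (cong (λ x → 𝟙 (x ≟F v)) (periodic a)) (count-+period f L periodic v (suc a) k)

count-+periods : ∀ {n} (f : ℕ → Fin n) L → (∀ p → f (p + L) ≡ f p) → ∀ v a t k → count f v (a + t * L) k ≡ count f v a k
count-+periods f L periodic v a zero k = cong (λ x → count f v x k) (+-identityʳ a)
count-+periods f L periodic v a (suc t) k = cong (λ x → count f v x k) (ar a L t) ∙ count-+period f L periodic v (a + t * L) k ∙ count-+periods f L periodic v a t k
  where ar : ∀ a L t → a + suc t * L ≡ a + t * L + L
        ar = solve-∀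

periodic-+periods : ∀ {n} (f : ℕ → Fin n) L → (∀ p → f (p + L) ≡ f p) → ∀ a t → f (a + t * L) ≡ f a
periodic-+periods f L periodic a zero = cong f (+-identityʳ a)
periodic-+periods f L periodic a (suc t) = cong f (ar a L t) ∙ periodic (a + t * L) ∙ periodic-+periods f L periodic a t
  where ar : ∀ a L t → a + suc t * L ≡ a + t * L + L
        ar = solve-∀

count-suc-window : ∀ {n} (f : ℕ → Fin n) L → (∀ p → f (p + L) ≡ f p) → ∀ v a → count f v (suc a) L ≡ count f v a L
count-suc-window f L periodic v a = +-cancelˡ-≡ (𝟙 (f a ≟F v)) _ _ (e1 ∙ sym e2)
  where
  e1 : 𝟙 (f a ≟F v) + count f v (suc a) L ≡ count f v a L + 𝟙 (f a ≟F v)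
  e1 = cong (count f v a) (+-comm 1 L) ∙ count-+ f v a L 1 ∙ cong (count f v a L +_) (cong (λ x → 𝟙 (x ≟F v) + 0) (periodic a) ∙ +-identityʳ _)
  e2 : 𝟙 (f a ≟F v) + count f v a L ≡ count f v a L + 𝟙 (f a ≟F v)
  e2 = +-comm (𝟙 (f a ≟F v)) (count f v a L)

-- The periodic unfolding of a cyclic double occurrence word whose interlacement graph is G: the
-- letter at p is adjacent to v iff v occurs exactly once strictly inside the chord from p to the
-- other occurrence of f p.
record ChordWord {n} (G : Graph n) : Set where
  field
    L : ℕ
    f : ℕ → Fin n
    periodic : ∀ p → f (p + L) ≡ f p
    twice : ∀ v a → count f v a L ≡ 2
    chord-adj : ∀ p k v → f p ≡ f (suc p + k) → suc k < L → (E G (f p) v ⇔ count f v (suc p) k ≡ 1)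

rotate : ∀ {n} {G : Graph n} → ChordWord G → ℕ → ChordWord G
rotate {G = G} s w = record
  { L = L
  ; f = λ p → f (w + p)
  ; periodic = λ p → cong f (sym (+-assoc w p L)) ∙ periodic (w + p)
  ; twice = λ v a → count-shift f w v a L ∙ twice v (w + a)
  ; chord-adj = λ p k v e lt →
      let e' = e ∙ cong f (+-suc w (p + k) ∙ cong suc (sym (+-assoc w p k))) in
      let eq = Equivalence.to (chord-adj (w + p) k v e' lt) in
      let eq' = Equivalence.from (chord-adj (w + p) k v e' lt) in
      let c = count-shift f w v (suc p) k ∙ cong (λ x → count f v x k) (+-suc w p) in
      mk⇔ (λ h → c ∙ eq h) (λ h → eq' (sym c ∙ h))
  }
  where open ChordWord s

-- From double occurrence words to chord words

module _ {ℓ} {X : Set ℓ} (d : X) where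

  open import Data.List.Relation.Binary.Sublist.Propositional {A = X} using (_⊆_; _∷_; _∷ʳ_; minimum)

  lookupOr : List X → ℕ → X
  lookupOr [] p = d
  lookupOr (x ∷ xs) zero = x
  lookupOr (x ∷ xs) (suc p) = lookupOr xs p

  ∷⊆drop⇒position : ∀ {x xs} (ys : List X) k → (x ∷ xs) ⊆ drop k ys →
    ∃ λ q → k + q < length ys × lookupOr ys (k + q) ≡ x × xs ⊆ drop (suc (k + q)) ys
  ∷⊆drop⇒position (y ∷ ys) zero (refl ∷ s) = 0 , s≤s z≤n , refl , s
  ∷⊆drop⇒position (y ∷ ys) zero (.y ∷ʳ s) with ∷⊆drop⇒position ys zero s
  ... | q , lt , e , s' = suc q , s≤s lt , e , s'
  ∷⊆drop⇒position (y ∷ ys) (suc k) s with ∷⊆drop⇒position ys k s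
  ... | q , lt , e , s' = q , s≤s lt , e , s'

  position⇒∷⊆drop : ∀ {x xs} (ys : List X) k q → k + q < length ys → lookupOr ys (k + q) ≡ x →
    xs ⊆ drop (suc (k + q)) ys → (x ∷ xs) ⊆ drop k ys
  position⇒∷⊆drop (y ∷ ys) zero zero _ refl s = refl ∷ s
  position⇒∷⊆drop (y ∷ ys) zero (suc q) (s≤s lt) e s = y ∷ʳ position⇒∷⊆drop ys zero q lt e s
  position⇒∷⊆drop (y ∷ ys) (suc k) q (s≤s lt) e s = position⇒∷⊆drop ys k q lt e s

  ⊆-four⇒positions : ∀ {a b c e} (ys : List X) → (a ∷ b ∷ c ∷ e ∷ []) ⊆ ys →
    ∃ λ p1 → ∃ λ p2 → ∃ λ p3 → ∃ λ p4 → p1 < p2 × p2 < p3 × p3 < p4 × p4 < length ys ×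
      lookupOr ys p1 ≡ a × lookupOr ys p2 ≡ b × lookupOr ys p3 ≡ c × lookupOr ys p4 ≡ e
  ⊆-four⇒positions ys s with ∷⊆drop⇒position ys 0 s
  ... | p1 , l1 , e1 , s1 with ∷⊆drop⇒position ys (suc p1) s1
  ... | q2 , l2 , e2 , s2 with ∷⊆drop⇒position ys (suc (suc p1 + q2)) s2
  ... | q3 , l3 , e3 , s3 with ∷⊆drop⇒position ys (suc (suc (suc p1 + q2) + q3)) s3
  ... | q4 , l4 , e4 , s4 =
    p1 , suc p1 + q2 , suc (suc p1 + q2) + q3 , suc (suc (suc p1 + q2) + q3) + q4 ,
    m≤m+n (suc p1) q2 , m≤m+n _ q3 , m≤m+n _ q4 , l4 , e1 , e2 , e3 , e4

  positions⇒⊆-four : ∀ {a b c e} (ys : List X) p1 p2 p3 p4 → p1 < p2 → p2 < p3 → p3 < p4 → p4 < length ys →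
    lookupOr ys p1 ≡ a → lookupOr ys p2 ≡ b → lookupOr ys p3 ≡ c → lookupOr ys p4 ≡ e →
    (a ∷ b ∷ c ∷ e ∷ []) ⊆ ys
  positions⇒⊆-four ys p1 p2 p3 p4 l12 l23 l34 l4 e1 e2 e3 e4 =
    after 0 p1 z≤n l1 e1 (after (suc p1) p2 l12 l2 e2 (after (suc p2) p3 l23 l3 e3 (after (suc p3) p4 l34 l4 e4 (minimum _))))
    where
    l3 = <-trans l34 l4
    l2 = <-trans l23 l3
    l1 = <-trans l12 l2
    after : ∀ {x xs} k p → k ≤ p → p < length ys → lookupOr ys p ≡ x → xs ⊆ drop (suc p) ys → (x ∷ xs) ⊆ drop k ys
    after k p k≤p lt e s =
      position⇒∷⊆drop ys k (p ∸ k) (subst (_< length ys) (sym eq) lt) (cong (lookupOr ys) eq ∙ e)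
                      (subst (λ t → _ ⊆ drop (suc t) ys) (sym eq) s)
      where
      eq : k + (p ∸ k) ≡ p
      eq = m+[n∸m]≡n k≤p

module DoubleOccurrenceWord {m} (W : List (Fin m)) (d : Fin m) (dbl : DoubleOccurrence W) where

  lk : ℕ → Fin m
  lk = lookupOr d W

  L = length W

  count-lookupOr : ∀ (ys : List (Fin m)) a → count (lookupOr d ys) a 0 (length ys) ≡ length (filter (_≟F a) ys)
  count-lookupOr [] a = refl
  count-lookupOr (x ∷ xs) a with x ≟F a
  ... | yes _ = cong suc (sym (count-shift (lookupOr d (x ∷ xs)) 1 a 0 (length xs)) ∙ count-lookupOr xs a)
  ... | no _ = sym (count-shift (lookupOr d (x ∷ xs)) 1 a 0 (length xs)) ∙ count-lookupOr xs a

  count-word : ∀ a → count lk a 0 L ≡ 2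
  count-word a = count-lookupOr W a ∙ dbl a

  position-is-one-of : ∀ i j p → i < j → j < L → p < L → lk i ≡ lk j → lk p ≡ lk i → p ≡ i ⊎ p ≡ j
  position-is-one-of i j p i<j j<L p<L eij epi =
    count≤2⇒hit-is-one-of lk 0 L (≤-reflexive (count-word _)) i<j j<L p<L refl (sym eij) epi

  module Chord (i j : ℕ) (i<j : i < j) (j<L : j < L) (eij : lk i ≡ lk j) where
    k = j ∸ suc i
    ek : suc i + k ≡ j
    ek = m+[n∸m]≡n i<j
    r = L ∸ j
    er : j + r ≡ L
    er = m+[n∸m]≡n (<⇒≤ j<L)

    left-inside-right : ∀ b → count lk b 0 (suc i) + count lk b (suc i) k + count lk b j r ≡ 2
    left-inside-right b =
      cong (_+ count lk b j r) (sym (count-+ lk b 0 (suc i) k))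
      ∙ cong (λ t → count lk b 0 (suc i + k) + count lk b t r) (sym ek)
      ∙ sym (count-+ lk b 0 (suc i + k) r) ∙ cong (count lk b 0) (cong (_+ r) ek ∙ er) ∙ count-word b

    inside-hit : ∀ b p → i < p → p < j → lk p ≡ b → 1 ≤ count lk b (suc i) k
    inside-hit b p i<p p<j e = hit⇒1≤count lk b (suc i) k (p ∸ suc i) (∸-monoˡ-< p<j i<p) (cong lk (m+[n∸m]≡n i<p) ∙ e)

    right-hit : ∀ b p → j < p → p < L → lk p ≡ b → 1 ≤ count lk b j r
    right-hit b p j<p p<L e = hit⇒1≤count lk b j r (p ∸ j) (∸-monoˡ-< p<L (<⇒≤ j<p)) (cong lk (m+[n∸m]≡n (<⇒≤ j<p)) ∙ e)

    left-hit : ∀ b p → p < i → lk p ≡ b → 1 ≤ count lk b 0 (suc i)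
    left-hit b p p<i e = hit⇒1≤count lk b 0 (suc i) p (<-trans p<i (n<1+n i)) e

    middle≤1 : ∀ x y z → 1 ≤ z → x + y + z ≡ 2 → y ≤ 1
    middle≤1 x y z hz e = ≤-trans (m≤n+m y x) (+-cancelʳ-≤ z (x + y) 1 (≤-trans (≤-reflexive e) (+-monoʳ-≤ 1 hz)))

    middle≤1′ : ∀ x y z → 1 ≤ x → x + y + z ≡ 2 → y ≤ 1
    middle≤1′ x y z hx e = ≤-trans (m≤m+n y z) (+-cancelˡ-≤ 1 _ _ (≤-trans (+-monoˡ-≤ (y + z) hx) (≤-reflexive (sym (+-assoc x y z) ∙ e))))

    abab⇒once-inside : ∀ b p1 p2 p3 p4 → p1 < p2 → p2 < p3 → p3 < p4 → p4 < L →
      lk p2 ≡ b → lk p4 ≡ b → (p1 ≡ i ⊎ p1 ≡ j) → (p3 ≡ i ⊎ p3 ≡ j) → count lk b (suc i) k ≡ 1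
    abab⇒once-inside b p1 p2 p3 p4 l12 l23 l34 l4 e2 e4 (inj₁ refl) (inj₂ refl) =
      ≤-antisym (middle≤1 (count lk b 0 (suc i)) _ _ (right-hit b p4 l34 l4 e4) (left-inside-right b)) (inside-hit b p2 l12 l23 e2)
    abab⇒once-inside b p1 p2 p3 p4 l12 l23 l34 l4 e2 e4 (inj₁ refl) (inj₁ refl) = ⊥-elim (<-irrefl refl (<-trans l12 l23))
    abab⇒once-inside b p1 p2 p3 p4 l12 l23 l34 l4 e2 e4 (inj₂ refl) (inj₂ refl) = ⊥-elim (<-irrefl refl (<-trans l12 l23))
    abab⇒once-inside b p1 p2 p3 p4 l12 l23 l34 l4 e2 e4 (inj₂ refl) (inj₁ refl) = ⊥-elim (<-irrefl refl (<-trans i<j (<-trans l12 l23)))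

    baba⇒once-inside : ∀ b p1 p2 p3 p4 → p1 < p2 → p2 < p3 → p3 < p4 →
      lk p1 ≡ b → lk p3 ≡ b → (p2 ≡ i ⊎ p2 ≡ j) → (p4 ≡ i ⊎ p4 ≡ j) → count lk b (suc i) k ≡ 1
    baba⇒once-inside b p1 p2 p3 p4 l12 l23 l34 e1 e3 (inj₁ refl) (inj₂ refl) =
      ≤-antisym (middle≤1′ (count lk b 0 (suc i)) _ _ (left-hit b p1 l12 e1) (left-inside-right b)) (inside-hit b p3 l23 l34 e3)
    baba⇒once-inside b p1 p2 p3 p4 l12 l23 l34 e1 e3 (inj₁ refl) (inj₁ refl) = ⊥-elim (<-irrefl refl (<-trans l23 l34))
    baba⇒once-inside b p1 p2 p3 p4 l12 l23 l34 e1 e3 (inj₂ refl) (inj₂ refl) = ⊥-elim (<-irrefl refl (<-trans l23 l34))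
    baba⇒once-inside b p1 p2 p3 p4 l12 l23 l34 e1 e3 (inj₂ refl) (inj₁ refl) = ⊥-elim (<-irrefl refl (<-trans i<j (<-trans l23 l34)))

    interlaced⇒once-inside : ∀ b → Interlaced W (lk i) b → count lk b (suc i) k ≡ 1
    interlaced⇒once-inside b (inj₁ s) =
      let (p1 , p2 , p3 , p4 , l12 , l23 , l34 , l4 , e1 , e2 , e3 , e4) = ⊆-four⇒positions d W s in
      abab⇒once-inside b p1 p2 p3 p4 l12 l23 l34 l4 e2 e4
        (position-is-one-of i j p1 i<j j<L (<-trans l12 (<-trans l23 (<-trans l34 l4))) eij e1)
        (position-is-one-of i j p3 i<j j<L (<-trans l34 l4) eij e3)
    interlaced⇒once-inside b (inj₂ s) =
      let (p1 , p2 , p3 , p4 , l12 , l23 , l34 , l4 , e1 , e2 , e3 , e4) = ⊆-four⇒positions d W s in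
      baba⇒once-inside b p1 p2 p3 p4 l12 l23 l34 e1 e3
        (position-is-one-of i j p2 i<j j<L (<-trans l23 (<-trans l34 l4)) eij e2)
        (position-is-one-of i j p4 i<j j<L l4 eij e4)

    -- The single inside occurrence of b is paired with one outside, either after j (abab) or before i (baba).
    once-inside⇒interlaced : ∀ b → count lk b (suc i) k ≡ 1 → Interlaced W (lk i) b
    once-inside⇒interlaced b h =
      let (r0 , r0<k , er0) = 1≤count⇒hit lk b (suc i) k (≤-reflexive (sym h)) in
      let rr = suc i + r0 in
      let i<r : i < rr
          i<r = s≤s (m≤m+n i r0) in
      let r<j : rr < j
          r<j = subst (rr <_) ek (+-monoʳ-< (suc i) r0<k) in
      let b≢a : b ≢ lk i
          b≢a = λ e → strictly-inside (position-is-one-of i j rr i<j j<L (<-trans r<j j<L) eij (er0 ∙ e)) i<r r<j in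
      let outer : count lk b 0 (suc i) + count lk b j r ≡ 1
          outer = suc-injective (+-comm 1 (count lk b 0 (suc i) + count lk b j r)
                  ∙ move-1 (count lk b 0 (suc i)) (count lk b j r)
                  ∙ subst (λ t → count lk b 0 (suc i) + t + count lk b j r ≡ 2) h (left-inside-right b)) in
      pick rr i<r r<j er0 b≢a (count lk b 0 (suc i)) refl outer
      where
      move-1 : ∀ x y → x + y + 1 ≡ x + 1 + y
      move-1 = solve-∀
      strictly-inside : ∀ {p} → p ≡ i ⊎ p ≡ j → i < p → p < j → ⊥
      strictly-inside (inj₁ refl) i<p _ = <-irrefl refl i<p
      strictly-inside (inj₂ refl) _ p<j = <-irrefl refl p<j
      pick : ∀ rr → i < rr → rr < j → lk rr ≡ b → b ≢ lk i →
        ∀ x → x ≡ count lk b 0 (suc i) → x + count lk b j r ≡ 1 → Interlaced W (lk i) b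
      pick rr i<r r<j erb b≢a zero ex o =
        let (q , q<r , eq) = 1≤count⇒hit lk b j r (≤-reflexive (sym o)) in
        let q≢0 : q ≢ 0
            q≢0 = λ e → b≢a (sym eq ∙ cong lk (cong (j +_) e ∙ +-identityʳ j) ∙ sym eij) in
        let j<jq : j < j + q
            j<jq = subst (_< j + q) (+-identityʳ j) (+-monoʳ-< j (n≢0⇒n>0 q≢0)) in
        inj₁ (positions⇒⊆-four d W i rr j (j + q) i<r r<j j<jq (subst (j + q <_) er (+-monoʳ-< j q<r)) refl erb (sym eij) eq)
      pick rr i<r r<j erb b≢a (suc x) ex o =
        let (p , p<si , ep) = 1≤count⇒hit lk b 0 (suc i) (≤-trans (s≤s z≤n) (≤-reflexive ex)) in
        let p<i : p < i
            p<i = ≤∧≢⇒< (≤-pred p<si) (λ e → b≢a (sym ep ∙ cong lk e)) in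
        inj₂ (positions⇒⊆-four d W p i rr j p<i i<r r<j j<L ep refl erb (sym eij))

    interlaced⇔once-inside : ∀ b → Interlaced W (lk i) b ⇔ count lk b (suc i) k ≡ 1
    interlaced⇔once-inside b = mk⇔ (interlaced⇒once-inside b) (once-inside⇒interlaced b)

module CyclicWord {m} (w0 : Fin m) (W' : List (Fin m)) (dbl : DoubleOccurrence (w0 ∷ W')) where
  W = w0 ∷ W'
  open DoubleOccurrenceWord (w0 ∷ W') w0 dbl public

  L' = length W'

  g : ℕ → Fin m
  g p = lk (p % suc L')

  perg : ∀ p → g (p + L) ≡ g p
  perg p = cong lk ([m+n]%n≡m%n p (suc L'))

  g-lt : ∀ p → p < L → g p ≡ lk p
  g-lt p h = cong lk (m<n⇒m%n≡m h)

  cyclic-twice : ∀ b a → count g b a L ≡ 2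
  cyclic-twice b zero = count-cong g lk b 0 L (λ i i<L → g-lt i i<L) ∙ count-word b
  cyclic-twice b (suc a) = count-suc-window g L perg b a ∙ cyclic-twice b a

  unwrapped-chord-adj : ∀ p k b → p < L → g p ≡ g (suc p + k) → suc p + k < L →
    Interlaced W (g p) b ⇔ count g b (suc p) k ≡ 1
  unwrapped-chord-adj p k b p<L e q<L =
    mk⇔ (λ h → same-count ∙ subst (λ t → count lk b (suc p) t ≡ 1) k≡ (Equivalence.to chord (subst (λ x → Interlaced W x b) (g-lt p p<L) h)))
        (λ h → subst (λ x → Interlaced W x b) (sym (g-lt p p<L)) (Equivalence.from chord (subst (λ t → count lk b (suc p) t ≡ 1) (sym k≡) (sym same-count ∙ h))))
    where
    chord = Chord.interlaced⇔once-inside p (suc p + k) (s≤s (m≤m+n p k)) q<L (sym (g-lt p p<L) ∙ e ∙ g-lt _ q<L) b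
    k≡ : suc p + k ∸ suc p ≡ k
    k≡ = m+n∸m≡n (suc p) k
    same-count : count g b (suc p) k ≡ count lk b (suc p) k
    same-count = count-cong g lk b (suc p) k (λ i i<k → g-lt _ (≤-trans (s≤s (+-monoʳ-≤ (suc p) (<⇒≤ i<k))) q<L))

  -- The chord from p wraps around to its partner j < p; its inside is the complement of the inside
  -- of the chord from j to p, minus the two ends, so a letter occurs once in one iff in the other.
  wrapped-chord-adj : ∀ p k b → p < L → g p ≡ g (suc p + k) → suc k < L → L ≤ suc p + k →
    Interlaced W (g p) b ⇔ count g b (suc p) k ≡ 1
  wrapped-chord-adj p k b p<L e lt L≤q =
    mk⇔ (λ h → outside ∙ Equivalence.from outside⇔inside
                   (subst (λ t → count lk b (suc j) t ≡ 1) r1≡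
                     (Equivalence.to chord (subst (λ x → Interlaced W x b) (g-lt p p<L ∙ sym fj≡fp) h))))
        (λ h → subst (λ x → Interlaced W x b) (fj≡fp ∙ sym (g-lt p p<L))
                 (Equivalence.from chord (subst (λ t → count lk b (suc j) t ≡ 1) (sym r1≡)
                   (Equivalence.to outside⇔inside (sym outside ∙ h)))))
    where
    j = suc p + k ∸ L
    j+L≡q : j + L ≡ suc p + k
    j+L≡q = m∸n+n≡m L≤q
    j<p : j < p
    j<p = +-cancelʳ-< L j p (subst (_< p + L) (sym j+L≡q) (subst (_≤ p + L) (ar0 p k) (+-monoʳ-≤ p lt)))
      where ar0 : ∀ p k → p + suc (suc k) ≡ suc (suc p + k)
            ar0 = solve-∀
    fj≡fp : lk j ≡ lk p
    fj≡fp = sym (g-lt j (<-trans j<p p<L)) ∙ sym (perg j) ∙ cong g j+L≡q ∙ sym e ∙ g-lt p p<L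
    r1 = proj₁ (≤⇒+ j<p)
    p≡ : p ≡ suc j + r1
    p≡ = proj₂ (≤⇒+ j<p)
    r2 = proj₁ (≤⇒+ p<L)
    L≡ : L ≡ suc p + r2
    L≡ = proj₂ (≤⇒+ p<L)
    chord = Chord.interlaced⇔once-inside j p j<p p<L fj≡fp b
    r1≡ : p ∸ suc j ≡ r1
    r1≡ = cong (_∸ suc j) p≡ ∙ m+n∸m≡n (suc j) r1
    Y = count lk b 0 j
    X = count lk b (suc j) r1
    A = count lk b (suc p) r2
    c = 𝟙 (lk j ≟F b)
    outside : count g b (suc p) k ≡ A + Y
    outside = cong (count g b (suc p)) k≡ ∙ count-+ g b (suc p) r2 j
              ∙ cong₂ _+_ (count-cong g lk b (suc p) r2 (λ i i<r2 → g-lt _ (subst (suc p + i <_) (sym L≡) (+-monoʳ-< (suc p) i<r2))))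
                          (cong (λ t → count g b t j) (sym L≡) ∙ count-+period g L perg b 0 j
                           ∙ count-cong g lk b 0 j (λ i i<j → g-lt i (<-trans i<j (<-trans j<p p<L))))
      where
      k≡ : k ≡ r2 + j
      k≡ = +-cancelˡ-≡ (suc p) _ _ (sym j+L≡q ∙ cong (j +_) L≡ ∙ ar j p r2)
        where ar : ∀ j p r2 → j + (suc p + r2) ≡ suc p + (r2 + j)
              ar = solve-∀
    total : Y + c + X + c + A ≡ 2
    total = ar1 Y c X A ∙ cong (λ t → Y + (c + (X + (𝟙 (t ≟F b) + A)))) fj≡fp
            ∙ cong (λ t → Y + (c + (X + (𝟙 (lk t ≟F b) + count lk b (suc t) r2)))) p≡
            ∙ sym split ∙ cong (count lk b 0) (sym (L≡ ∙ cong (λ t → suc t + r2) p≡ ∙ ar2 j r1 r2)) ∙ count-word b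
      where
      ar1 : ∀ Y c X A → Y + c + X + c + A ≡ Y + (c + (X + (c + A)))
      ar1 = solve-∀
      ar2 : ∀ j r1 r2 → suc (suc j + r1) + r2 ≡ j + suc (r1 + suc r2)
      ar2 = solve-∀
      split : count lk b 0 (j + suc (r1 + suc r2)) ≡ Y + (c + (X + (𝟙 (lk (suc j + r1) ≟F b) + count lk b (suc (suc j + r1)) r2)))
      split = count-+ lk b 0 j (suc (r1 + suc r2)) ∙ cong (λ t → Y + (c + t)) (count-+ lk b (suc j) r1 (suc r2))
    outside⇔inside = complement-once⇔once Y X A c total (𝟙≤1 _)

  cyclic-chord-adj< : ∀ p k b → p < L → g p ≡ g (suc p + k) → suc k < L → Interlaced W (g p) b ⇔ count g b (suc p) k ≡ 1
  cyclic-chord-adj< p k b p<L e lt with suc p + k <? L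
  ... | yes q<L = unwrapped-chord-adj p k b p<L e q<L
  ... | no q≮L = wrapped-chord-adj p k b p<L e lt (≤-pred (≰⇒> q≮L))

  cyclic-chord-adj : ∀ p k b → g p ≡ g (suc p + k) → suc k < L → Interlaced W (g p) b ⇔ count g b (suc p) k ≡ 1
  cyclic-chord-adj p k b e lt =
    let p' = p % L in
    let t = p / L in
    let pe : p ≡ p' + t * L
        pe = m≡m%n+[m/n]*n p L in
    let gp : g p ≡ g p'
        gp = cong g pe ∙ periodic-+periods g L perg p' t in
    let gq : g (suc p + k) ≡ g (suc p' + k)
        gq = cong g (cong (λ x → suc x + k) pe ∙ ar p' (t * L) k) ∙ periodic-+periods g L perg (suc p' + k) t in
    let ce : count g b (suc p) k ≡ count g b (suc p') k
        ce = cong (λ x → count g b x k) (cong suc pe ∙ ar2 p' (t * L)) ∙ count-+periods g L perg b (suc p') t k in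
    let c = cyclic-chord-adj< p' k b (m%n<n p L) (sym gp ∙ e ∙ gq) lt in
    mk⇔ (λ h → ce ∙ Equivalence.to c (subst (λ x → Interlaced W x b) gp h))
        (λ h → subst (λ x → Interlaced W x b) (sym gp) (Equivalence.from c (sym ce ∙ h)))
    where
    ar : ∀ p' tL k → suc (p' + tL) + k ≡ suc p' + k + tL
    ar = solve-∀
    ar2 : ∀ p' tL → suc (p' + tL) ≡ suc p' + tL
    ar2 = solve-∀

word⇒chordWord : ∀ {n} (G : Graph n) {m} (w0 : Fin m) (W' : List (Fin m)) (dbl : DoubleOccurrence (w0 ∷ W')) (φ : Fin n ↔ Fin m)
        (iso : ∀ u v → E G u v ⇔ Interlaced (w0 ∷ W') (Inverse.to φ u) (Inverse.to φ v)) → ChordWord G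
word⇒chordWord {n} G {m} w0 W' dbl φ iso = record
  { L = L
  ; f = f
  ; periodic = λ p → cong from (perg p)
  ; twice = λ v a → count-relabel f g v (to v) (fg v) (gf v) a L ∙ cyclic-twice (to v) a
  ; chord-adj = λ p k v e lt →
      let gpq : g p ≡ g (suc p + k)
          gpq = sym (ti (g p)) ∙ cong to e ∙ ti (g (suc p + k)) in
      let c = cyclic-chord-adj p k (to v) gpq lt in
      let ce = count-relabel f g v (to v) (fg v) (gf v) (suc p) k in
      mk⇔ (λ h → ce ∙ Equivalence.to c (subst (λ x → Interlaced (w0 ∷ W') x (to v)) (ti (g p)) (Equivalence.to (iso (f p) v) h)))
          (λ h → Equivalence.from (iso (f p) v) (subst (λ x → Interlaced (w0 ∷ W') x (to v)) (sym (ti (g p))) (Equivalence.from c (sym ce ∙ h))))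
  }
  where
  open CyclicWord w0 W' dbl
  to = Inverse.to φ
  from = Inverse.from φ
  ti : ∀ x → to (from x) ≡ x
  ti = Inverse.strictlyInverseˡ φ
  it : ∀ x → from (to x) ≡ x
  it = Inverse.strictlyInverseʳ φ
  f : ℕ → Fin n
  f p = from (g p)
  fg : ∀ v p → f p ≡ v → g p ≡ to v
  fg v p e = sym (ti (g p)) ∙ cong to e
  gf : ∀ v p → g p ≡ to v → f p ≡ v
  gf v p e = cong from e ∙ it v

circle⇒chordWord : ∀ {n} (G : Graph n) → 0 < n → CircleGraph G → ChordWord G
circle⇒chordWord G 0<n (m , [] , dbl , φ , _) with dbl (Inverse.to φ (fromℕ< 0<n))
... | ()
circle⇒chordWord G _ (m , w0 ∷ W' , dbl , φ , iso) = word⇒chordWord G w0 W' dbl φ iso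

module ChordWordFacts {n} {G : Graph n} (s : ChordWord G) where
  open ChordWord s public

  no-third-hit : ∀ a i j l → i < j → j < l → l < L → f (a + i) ≡ f (a + j) → f (a + i) ≡ f (a + l) → ⊥
  no-third-hit a i j l i<j j<l l<L e1 e2 =
    count≤2⇒no-third-hit f a L (≤-reflexive (twice _ a)) i<j j<l l<L refl (sym e1) (sym e2)

  2≤L : 2 ≤ L
  2≤L = ≤-trans (≤-reflexive (sym (twice (f 0) 0))) (count≤ f (f 0) 0 L)

  second-hit : ∀ p → ∃ λ k → suc k < L × f (suc p + k) ≡ f p
  second-hit p with L | twice (f p) p | 2≤L
  ... | suc L' | w | _ with f p ≟F f p
  ...   | no ne = ⊥-elim (ne refl)
  ...   | yes _ with 1≤count⇒hit f (f p) (suc p) L' (≤-reflexive (sym (suc-injective w)))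
  ...     | i , i<L' , e = i , s≤s i<L' , e

  periodic* : ∀ j p → f (p + j * L) ≡ f p
  periodic* j p = periodic-+periods f L periodic p j

  hit-is-one-of : ∀ a i j l → i < j → j < L → l < L → f (a + i) ≡ f (a + j) → f (a + l) ≡ f (a + i) → l ≡ i ⊎ l ≡ j
  hit-is-one-of a i j l i<j j<L l<L eij eli =
    count≤2⇒hit-is-one-of f a L (≤-reflexive (twice _ a)) i<j j<L l<L refl (sym eij) eli

  three-distinct-hits : ∀ x y z → x < L → y < L → z < L → x ≢ y → x ≢ z → y ≢ z → f x ≡ f y → f x ≡ f z → ⊥
  three-distinct-hits x y z x<L y<L z<L x≢y x≢z y≢z fx≡fy fx≡fz with <-cmp x y
  ... | tri< x<y _ _ = z-is-not (hit-is-one-of 0 x y z x<y y<L z<L fx≡fy (sym fx≡fz)) x≢z y≢z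
    where
    z-is-not : z ≡ x ⊎ z ≡ y → x ≢ z → y ≢ z → ⊥
    z-is-not (inj₁ z≡x) x≢z _ = x≢z (sym z≡x)
    z-is-not (inj₂ z≡y) _ y≢z = y≢z (sym z≡y)
  ... | tri≈ _ x≡y _ = x≢y x≡y
  ... | tri> _ _ y<x with hit-is-one-of 0 y x z y<x x<L z<L (sym fx≡fy) (sym fx≡fz ∙ fx≡fy)
  ...   | inj₁ z≡y = y≢z (sym z≡y)
  ...   | inj₂ z≡x = x≢z (sym z≡x)

  once-before-last : ∀ b k m z → L ≡ k + m → ∀ i → i < k → f (b + i) ≡ z → ∀ e → e < m → f (b + k + e) ≡ z → count f z b k ≡ 1
  once-before-last b k m z Lk i i<k ei e e<m ee =
    x+y≡2⇒x≡1 _ _ (hit⇒1≤count f z b k i i<k ei) (hit⇒1≤count f z (b + k) m e e<m ee)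
      (sym (count-+ f z b k m) ∙ cong (count f z b) (sym Lk) ∙ twice z b)

  once-after-first : ∀ o d k r z → L ≡ suc d + k + r → f o ≡ z → ∀ i → i < k → f (o + suc d + i) ≡ z → count f z (o + suc d) k ≡ 1
  once-after-first o d k r z Lk eo i i<k ei =
    x+y+w≡2⇒y≡1 _ _ _ (hit⇒1≤count f z o (suc d) 0 (s≤s z≤n) (cong f (+-identityʳ o) ∙ eo)) (hit⇒1≤count f z (o + suc d) k i i<k ei)
      (cong (_+ count f z (o + suc d + k) r) (sym (count-+ f z o (suc d) k))
       ∙ cong (λ x → count f z o (suc d + k) + count f z x r) (+-assoc o (suc d) k)
       ∙ sym (count-+ f z o (suc d + k) r)
       ∙ cong (count f z o) (sym Lk) ∙ twice z o)

  L≡2n : L ≡ n * 2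
  L≡2n = sym (∑-count f 0 L) ∙ ∑-cong (λ v → twice v 0) ∙ ∑-const n 2

  1≤L : 1 ≤ L
  1≤L = ≤-trans (s≤s z≤n) 2≤L

  reduce-below : ∀ b fuel q → q < fuel → b ≤ q → ∃ λ q' → b ≤ q' × q' < b + L × f q' ≡ f q × ∃ λ t → q' + t * L ≡ q
  reduce-below b (suc fuel) q q<fu b≤q with q <? b + L
  ... | yes h = q , b≤q , h , refl , 0 , +-identityʳ q
  ... | no h =
    let bL≤q = ≤-pred (≰⇒> h) in
    let L≤q = ≤-trans (m≤n+m L b) bL≤q in
    let q' = q ∸ L in
    let eq : q' + L ≡ q
        eq = m∸n+n≡m L≤q in
    let q'<q : q' < q
        q'<q = ≤-trans (≤-reflexive (sym (+-comm q' 1))) (≤-trans (+-monoʳ-≤ q' 1≤L) (≤-reflexive eq)) in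
    let b≤q' : b ≤ q'
        b≤q' = ≤-trans (≤-reflexive (sym (m+n∸n≡m b L))) (∸-monoˡ-≤ L bL≤q) in
    let (q'' , b≤ , lt , fe , t , te) = reduce-below b fuel q' (≤-trans q'<q (≤-pred q<fu)) b≤q' in
    q'' , b≤ , lt , fe ∙ sym (periodic q') ∙ cong f eq , suc t , (ar q'' L t ∙ cong (_+ L) te ∙ eq)
    where
    ar : ∀ x L t → x + (L + t * L) ≡ x + t * L + L
    ar = solve-∀

  reduce-into-window : ∀ b p → ∃ λ q → b ≤ q × q < b + L × f q ≡ f p × ∃₂ λ t u → q + t * L ≡ p + u * L
  reduce-into-window b p =
    let q0 = p + b * L in
    let b≤ : b ≤ q0
        b≤ = ≤-trans (≤-trans (≤-reflexive (sym (*-identityʳ b))) (*-monoʳ-≤ b 1≤L)) (m≤n+m (b * L) p) in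
    let (q , h1 , h2 , h3 , t , e) = reduce-below b (suc q0) q0 ≤-refl b≤ in
    q , h1 , h2 , h3 ∙ periodic* b p , t , b , e

Chained : ∀ {n} {G : Graph n} → ChordWord G → Set
Chained s = ∀ j → ChordWord.f s (3 * j) ≡ ChordWord.f s (3 * j + 4)

chain-rotate : ∀ {n} {G : Graph n} (s : ChordWord G) → Chained s → ∀ i → Chained (rotate s (3 * i))
chain-rotate s ch i j = cong (ChordWord.f s) (ar i j) ∙ ch (i + j) ∙ cong (ChordWord.f s) (ar2 i j)
  where ar : ∀ i j → 3 * i + 3 * j ≡ 3 * (i + j)
        ar = solve-∀
        ar2 : ∀ i j → 3 * (i + j) + 4 ≡ 3 * i + (3 * j + 4)
        ar2 = solve-∀

M : ℕ → ℕ
M j = 3 * j + 2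

-- Up to renaming the letters, the word is 0 3 4 5 0 2 1 5 4 3 1 2, whose interlacement graph is
-- K₃,₃ with sides {0, 1, 2} and {3, 4, 5}.
module K33Word {n} {G : Graph n} (s : ChordWord G) (L≡12 : ChordWord.L s ≡ 12) (chain : Chained s)
               (f2≡f8 : ChordWord.f s 2 ≡ ChordWord.f s 8) (f5≡f11 : ChordWord.f s 5 ≡ ChordWord.f s 11) where
  open ChordWordFacts s

  letter : ℕ → Fin 6
  letter 0 = 0F
  letter 1 = 3F
  letter 2 = 4F
  letter 3 = 5F
  letter 4 = 0F
  letter 5 = 2F
  letter 6 = 1F
  letter 7 = 5F
  letter 8 = 4F
  letter 9 = 3F
  letter 10 = 1F
  letter 11 = 2F
  letter _ = 0F

  first gap second : Fin 6 → ℕ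
  first 0F = 0
  first 1F = 6
  first 2F = 5
  first 3F = 1
  first 4F = 2
  first 5F = 3
  gap 0F = 3
  gap 1F = 3
  gap 2F = 5
  gap 3F = 7
  gap 4F = 5
  gap 5F = 3
  second i = suc (first i) + gap i

  ψ : Fin 6 → Fin n
  ψ i = f (first i)

  letter-first : ∀ i → letter (first i) ≡ i
  letter-first 0F = refl
  letter-first 1F = refl
  letter-first 2F = refl
  letter-first 3F = refl
  letter-first 4F = refl
  letter-first 5F = refl

  letter-second : ∀ i → letter (second i) ≡ i
  letter-second 0F = refl
  letter-second 1F = refl
  letter-second 2F = refl
  letter-second 3F = refl
  letter-second 4F = refl
  letter-second 5F = refl

  first<second : ∀ i → first i < second i
  first<second i = s≤s (m≤m+n (first i) (gap i))

  second<12 : ∀ i → second i < 12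
  second<12 0F = m≤m+n 5 7
  second<12 1F = m≤m+n 11 1
  second<12 2F = ≤-refl
  second<12 3F = m≤m+n 10 2
  second<12 4F = m≤m+n 9 3
  second<12 5F = m≤m+n 8 4

  <12⇒<L : ∀ {p} → p < 12 → p < L
  <12⇒<L = subst (_ <_) (sym L≡12)

  f1≡f9 : f 1 ≡ f 9
  f1≡f9 = sym (periodic 1) ∙ cong (λ x → f (1 + x)) L≡12 ∙ sym (chain 3)

  paired : ∀ i → f (first i) ≡ f (second i)
  paired 0F = chain 0
  paired 1F = chain 2
  paired 2F = f5≡f11
  paired 3F = f1≡f9
  paired 4F = f2≡f8
  paired 5F = chain 1

  f≡ψ∘letter : ∀ p → p < 12 → f p ≡ ψ (letter p)
  f≡ψ∘letter 0 _ = refl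
  f≡ψ∘letter 1 _ = refl
  f≡ψ∘letter 2 _ = refl
  f≡ψ∘letter 3 _ = refl
  f≡ψ∘letter 4 _ = sym (paired 0F)
  f≡ψ∘letter 5 _ = refl
  f≡ψ∘letter 6 _ = refl
  f≡ψ∘letter 7 _ = sym (paired 5F)
  f≡ψ∘letter 8 _ = sym (paired 4F)
  f≡ψ∘letter 9 _ = sym (paired 3F)
  f≡ψ∘letter 10 _ = sym (paired 1F)
  f≡ψ∘letter 11 _ = sym (paired 2F)
  f≡ψ∘letter (suc (suc (suc (suc (suc (suc (suc (suc (suc (suc (suc (suc p))))))))))))
    (s≤s (s≤s (s≤s (s≤s (s≤s (s≤s (s≤s (s≤s (s≤s (s≤s (s≤s (s≤s ()))))))))))))

  ψ-injective : ∀ i j → ψ i ≡ ψ j → i ≡ j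
  ψ-injective i j ψi≡ψj with i ≟F j
  ... | yes i≡j = i≡j
  ... | no i≢j = ⊥-elim (three-distinct-hits (first i) (first j) (second j)
                   (<12⇒<L (<-trans (first<second i) (second<12 i))) (<12⇒<L (<-trans (first<second j) (second<12 j)))
                   (<12⇒<L (second<12 j))
                   (λ e → i≢j (sym (letter-first i) ∙ cong letter e ∙ letter-first j))
                   (λ e → i≢j (sym (letter-first i) ∙ cong letter e ∙ letter-second j))
                   (λ e → <-irrefl e (first<second j))
                   ψi≡ψj (ψi≡ψj ∙ paired j))

  occurrence : ∀ v → ∃ λ p → p < 12 × f p ≡ v
  occurrence v =
    1≤count⇒hit f v 0 12 (subst (λ l → 1 ≤ count f v 0 l) L≡12 (≤-trans (s≤s z≤n) (≤-reflexive (sym (twice v 0)))))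

  φ : Fin n → Fin 6
  φ v = letter (proj₁ (occurrence v))

  ψφ : ∀ v → ψ (φ v) ≡ v
  ψφ v = let (p , p<12 , fp≡v) = occurrence v in sym (f≡ψ∘letter p p<12) ∙ fp≡v

  φψ : ∀ i → φ (ψ i) ≡ i
  φψ i = ψ-injective (φ (ψ i)) i (ψφ (ψ i))

  count-letter : ∀ i j → count f (ψ j) (suc (first i)) (gap i) ≡ count letter j (suc (first i)) (gap i)
  count-letter i j =
    count-cong f (ψ ∘ letter) (ψ j) (suc (first i)) (gap i)
      (λ x x<gap → f≡ψ∘letter _ (<-trans (+-monoʳ-< (suc (first i)) x<gap) (second<12 i)))
    ∙ count-relabel (ψ ∘ letter) letter (ψ j) j (λ p → ψ-injective (letter p) j) (λ p → cong ψ) (suc (first i)) (gap i)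

  once-inside? : ∀ i j → Dec (count letter j (suc (first i)) (gap i) ≡ 1)
  once-inside? i j = count letter j (suc (first i)) (gap i) ≟ 1

  opposite? : ∀ i j → Dec (K33-adj i j)
  opposite? i j = ¬? (side i Bool.≟ side j)

  -- Decided by evaluation over all 36 pairs of letters.
  once-inside≡opposite : ∀ i j → does (once-inside? i j) ≡ does (opposite? i j)
  once-inside≡opposite = toWitness {a? = all? λ i → all? λ j → does (once-inside? i j) Bool.≟ does (opposite? i j)} tt

  adjacent⇔K33 : ∀ i j → E G (ψ i) (ψ j) ⇔ K33-adj i j
  adjacent⇔K33 i j =
    Dec-⇔ (once-inside? i j) (opposite? i j) (once-inside≡opposite i j)
    ⇔-∘ (mk⇔ (λ e → sym (count-letter i j) ∙ e) (λ e → count-letter i j ∙ e)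
         ⇔-∘ chord-adj (first i) (gap i) (ψ j) (paired i) (<12⇒<L (≤-<-trans (s≤s (m≤n+m (gap i) (first i))) (second<12 i))))

  ≅K33 : IsoTo G 6 K33-adj
  ≅K33 = mk↔ₛ′ φ ψ φψ ψφ , edges
    where
    edges : ∀ u v → E G u v ⇔ K33-adj (φ u) (φ v)
    edges u v = subst₂ (λ x y → E G x y ⇔ K33-adj (φ u) (φ v)) (ψφ u) (ψφ v) (adjacent⇔K33 (φ u) (φ v))

-- Cubic 3-connected chord words

NoSeparatorBelow : ∀ {n} → ℕ → Graph n → Set
NoSeparatorBelow {n} k G = ∀ (S : List (Fin n)) → length S < k → ∀ u v → u ∉ S → v ∉ S → Reach G S u v

module Cubic3Connected {n} (G : Graph n) (cubic : Regular 3 G) (conn : NoSeparatorBelow 3 G) where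

  module Basic (s : ChordWord G) where
    open ChordWordFacts s public

    #once-inside-chord≡3 : ∀ p k → f p ≡ f (suc p + k) → suc k < L → #once f (suc p) k ≡ 3
    #once-inside-chord≡3 p k e lt =
      ∑-cong (λ z → 𝟙-cong (count f z (suc p) k ≟ 1) (E-dec G (f p) z)
                 (Equivalence.from (chord-adj p k z e lt)) (Equivalence.to (chord-adj p k z e lt)))
      ∙ sym (length-filter-allFin (E-dec G (f p))) ∙ cubic (f p)

    3≤chord-inside : ∀ p k → f p ≡ f (suc p + k) → suc k < L → 3 ≤ k
    3≤chord-inside p k e lt = subst (_≤ k) (#once-inside-chord≡3 p k e lt) (#once≤length f (suc p) k)

    -- The letters occurring once in the window form a set of at most two vertices; a neighbour
    -- outside it of a letter occurring twice lies inside that letter's chord, hence also occurs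
    -- twice, so no path avoiding the set leads from u to v.
    no-small-cut : ∀ a k → k ≤ L → ∀ u v → 2 ≤ count f u a k → count f v a k ≡ 0 → #once f a k ≤ 2 → ⊥
    no-small-cut a k k≤L u v u-twice v-absent #once≤2 = stays-doubled u (conn once |once|<3 u v u∉ v∉) u-twice
      where
      P? = λ z → count f z a k ≟ 1
      once = filter P? (allFin n)
      |once|<3 : length once < 3
      |once|<3 = s≤s (≤-trans (≤-reflexive (length-filter-allFin P?)) #once≤2)
      u∉ : u ∉ once
      u∉ m = <-irrefl (sym (proj₂ (∈-filter⁻ P? {xs = allFin n} m))) u-twice
      v∉ : v ∉ once
      v∉ m with trans (sym (proj₂ (∈-filter⁻ P? {xs = allFin n} m))) v-absent
      ... | ()
      doubled-spreads : ∀ x w → 2 ≤ count f x a k → E G x w → w ∉ once → 2 ≤ count f w a k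
      doubled-spreads x w hx exw w∉ with 2≤count⇒hit₂ f x a k hx
      ... | i , j , i<j , j<k , e1 , e2 =
        let kk = j ∸ suc i in
        let pos : suc (a + i) + kk ≡ a + j
            pos = cong suc (+-assoc a i kk) ∙ sym (+-suc a (i + kk)) ∙ cong (a +_) (m+[n∸m]≡n i<j) in
        let lt : suc kk < L
            lt = ≤-trans (s≤s (≤-reflexive (sym (+-∸-assoc 1 i<j)))) (≤-trans (s≤s (m∸n≤m j i)) (≤-trans j<k k≤L)) in
        let w-once-inside = Equivalence.to (chord-adj (a + i) kk w (e1 ∙ sym e2 ∙ cong f (sym pos)) lt) (subst (λ y → E G y w) (sym e1) exw) in
        let (r , r<kk , er) = 1≤count⇒hit f w (suc (a + i)) kk (≤-reflexive (sym w-once-inside)) in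
        let hit = hit⇒1≤count f w a k (suc (i + r))
                    (≤-trans (s≤s (+-monoʳ-< i r<kk)) (≤-trans (≤-reflexive (m+[n∸m]≡n i<j)) (<⇒≤ j<k)))
                    (cong f (+-suc a (i + r) ∙ cong suc (sym (+-assoc a i r))) ∙ er) in
        ≥1∧≢1⇒≥2 (count f w a k) hit (λ e → w∉ (∈-filter⁺ P? (∈-allFin w) e))
        where
        ≥1∧≢1⇒≥2 : ∀ x → 1 ≤ x → x ≢ 1 → 2 ≤ x
        ≥1∧≢1⇒≥2 (suc zero) _ ne = ⊥-elim (ne refl)
        ≥1∧≢1⇒≥2 (suc (suc x)) _ _ = s≤s (s≤s z≤n)
      stays-doubled : ∀ x → Reach G once x v → 2 ≤ count f x a k → ⊥
      stays-doubled x here hx with ≤-trans hx (≤-reflexive v-absent)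
      ... | ()
      stays-doubled x (step {w = w} exw w∉ r) hx = stays-doubled w r (doubled-spreads x w hx exw w∉)

    -- A letter occurring twice inside a chord spans a shorter chord; a chord with no doubled
    -- inside letter has exactly its three neighbours inside.
    span3-chord-below : ∀ fuel p k → k < fuel → f p ≡ f (suc p + k) → suc k < L → ∃ λ w → f w ≡ f (w + 4)
    span3-chord-below (suc fuel) p k k<fu e lt with any? (λ z → 2 ≤? count f z (suc p) k)
    ... | yes (z , hz) with 2≤count⇒hit₂ f z (suc p) k hz
    ...   | i , j , i<j , j<k , e1 , e2 =
      let kk = j ∸ suc i in
      let pos : suc (suc p + i) + kk ≡ suc p + j
          pos = cong suc (+-assoc (suc p) i kk) ∙ sym (+-suc (suc p) (i + kk)) ∙ cong (suc p +_) (m+[n∸m]≡n i<j) in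
      let kk<k : kk < k
          kk<k = ≤-trans (s≤s (m∸n≤m j (suc i))) j<k in
      span3-chord-below fuel (suc p + i) kk
        (≤-trans kk<k (≤-pred k<fu))
        (e1 ∙ sym e2 ∙ cong f (sym pos))
        (≤-trans (s≤s kk<k) (<⇒≤ lt))
    span3-chord-below (suc fuel) p k k<fu e lt | no ¬two =
      let k3 : k ≡ 3
          k3 = no-double⇒length≡#once f (suc p) k (¬∃⟶∀¬ ¬two) ∙ #once-inside-chord≡3 p k e lt in
      p , (e ∙ cong f (cong (suc p +_) k3 ∙ cong suc (+-comm p 3) ∙ +-comm 4 p))

    span3-chord : ∃ λ w → f w ≡ f (w + 4)
    span3-chord with second-hit 0
    ... | k , lt , e = span3-chord-below (suc k) 0 k ≤-refl (sym e) lt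

  module ChainStep (s : ChordWord G) (10≤L : 10 ≤ ChordWord.L s) (f0≡f4 : ChordWord.f s 0 ≡ ChordWord.f s 4) where
    open Basic s

    4<L : 4 < L
    4<L = ≤-trans (s≤s (s≤s (s≤s (s≤s (s≤s z≤n))))) 10≤L

    hit-of-f0 : ∀ l → l < L → f l ≡ f 0 → l ≡ 0 ⊎ l ≡ 4
    hit-of-f0 l l<L e = hit-is-one-of 0 0 4 l (s≤s z≤n) 4<L l<L f0≡f4 e

    f3≢f0 : f 3 ≢ f 0
    f3≢f0 e with hit-of-f0 3 (≤-trans (s≤s (s≤s (s≤s (s≤s z≤n)))) 4<L) e
    ... | inj₁ ()
    ... | inj₂ ()

    -- The chord from 3 contains f 4 = f 0 once; the window after position 4 misses f 0 and has exactly
    -- two letters occurring once, so by 3-connectivity no letter occurs twice in it and it has length 2.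
    chain-step : f 3 ≡ f 7
    chain-step with second-hit 3
    ... | k , lt , e with 3≤chord-inside 3 k (sym e) lt
    ... | k≥3 with k
    ... | suc k' = go
      where
      q<L : 4 + suc k' < L
      q<L with 4 + suc k' <? L
      ... | yes h = h
      ... | no h =
        let L≤ : L ≤ 4 + suc k'
            L≤ = ≤-pred (≰⇒> h) in
        let d = (4 + suc k') ∸ L in
        let dL : d + L ≡ 4 + suc k'
            dL = m∸n+n≡m L≤ in
        let fd : f d ≡ f 3
            fd = sym (periodic d) ∙ cong f dL ∙ e in
        let d≤2 : d ≤ 2
            d≤2 = ≤-trans (∸-monoˡ-≤ L (subst (_≤ L + 2) (ar k') (+-monoˡ-≤ 2 lt))) (≤-reflexive (m+n∸m≡n L 2)) in
        ⊥-elim (cases d d≤2 fd)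
        where
        ar : ∀ k' → suc (suc (suc k')) + 2 ≡ 4 + suc k'
        ar = solve-∀
        cases : ∀ d → d ≤ 2 → f d ≡ f 3 → ⊥
        cases zero _ fd = f3≢f0 (sym fd)
        cases (suc zero) _ fd with 3≤chord-inside 1 1 fd (≤-trans (s≤s (s≤s (s≤s z≤n))) 4<L)
        ... | s≤s ()
        cases (suc (suc zero)) _ fd with 3≤chord-inside 2 0 fd (≤-trans (s≤s (s≤s z≤n)) 4<L)
        ... | ()
        cases (suc (suc (suc d))) (s≤s (s≤s ()))
      cx : count f (f 0) 5 k' ≡ 0
      cx with count f (f 0) 5 k' in eq
      ... | zero = refl
      ... | suc c with 1≤count⇒hit f (f 0) 5 k' (≤-trans (s≤s z≤n) (≤-reflexive (sym eq)))
      ...   | i , i<k' , ei with hit-of-f0 (5 + i) (≤-trans (+-monoʳ-≤ 5 i<k') (<⇒≤ q<L)) ei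
      ...     | inj₁ ()
      ...     | inj₂ ()
      #5 : #once f 5 k' ≡ 2
      #5 = suc-injective (+-comm 1 _ ∙ h)
        where
        pt : ∀ z → 𝟙 (count f z 5 k' ≟ 1) + 𝟙 (f 0 ≟F z) ≡ 𝟙 (count f z 4 (suc k') ≟ 1)
        pt z with f 0 ≟F z
        pt z | yes refl rewrite cx with f 4 ≟F f 0
        ... | yes _ = refl
        ... | no ne = ⊥-elim (ne (sym f0≡f4))
        pt z | no ne with f 4 ≟F z
        ... | yes e4 = ⊥-elim (ne (f0≡f4 ∙ e4))
        ... | no _ = +-identityʳ _
        h : #once f 5 k' + 1 ≡ 3
        h = cong (#once f 5 k' +_) (sym (∑-𝟙-singleton {n = n} (f 0)))
            ∙ sym (∑-+ {n = n} (λ z → 𝟙 (count f z 5 k' ≟ 1)) (λ z → 𝟙 (f 0 ≟F z)))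
            ∙ ∑-cong {n = n} pt ∙ #once-inside-chord≡3 3 (suc k') (sym e) lt
      go : f 3 ≡ f 7
      go with k' ≟ 2
      ... | yes eq = sym e ∙ cong (λ t → f (4 + suc t)) eq
      ... | no ne with any? (λ z → 2 ≤? count f z 5 k')
      ... | yes (u , hu) = ⊥-elim (no-small-cut 5 k' (≤-trans (m≤n+m k' 3) lt) u (f 0) hu cx (≤-reflexive #5))
      ... | no ¬two = ⊥-elim (ne (no-double⇒length≡#once f 5 k' (¬∃⟶∀¬ ¬two) ∙ #5))

  chained : ∀ (s : ChordWord G) → 10 ≤ ChordWord.L s → ChordWord.f s 0 ≡ ChordWord.f s 4 → Chained s
  chained s 10≤L f0≡f4 zero = f0≡f4
  chained s 10≤L f0≡f4 (suc j) =
    cong f (sym (ar1 j)) ∙ ChainStep.chain-step (rotate s (3 * j)) 10≤L (cong f (+-identityʳ _) ∙ chained s 10≤L f0≡f4 j) ∙ cong f (ar2 j)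
    where
    open ChordWord s using (f)
    ar1 : ∀ j → 3 * j + 3 ≡ 3 * suc j
    ar1 = solve-∀
    ar2 : ∀ j → 3 * j + 7 ≡ 3 * suc j + 4
    ar2 = solve-∀

  module ThreeDividesLength (s : ChordWord G) (10≤L : 10 ≤ ChordWord.L s) (chain : Chained s) where
    open Basic s

    f4≢f8 : f 4 ≡ f 8 → ⊥
    f4≢f8 e = no-third-hit 0 0 4 8 (s≤s z≤n) (s≤s (s≤s (s≤s (s≤s (s≤s z≤n)))))
              (≤-trans (s≤s (s≤s (s≤s (s≤s (s≤s (s≤s (s≤s (s≤s (s≤s z≤n))))))))) 10≤L) (chain 0) (chain 0 ∙ e)

    -- If L ≢ 0 (mod 3) then 3 divides 4 + L or 4 + 2 L, and the chain pairs position 4 with 8 modulo L.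
    3∣L : ∃ λ a → L ≡ 3 * a
    3∣L with divmod3 L
    ... | a , inj₁ e = a , e
    ... | a , inj₂ (inj₁ e) = ⊥-elim (f4≢f8 (sym (periodic* 2 4) ∙ cong f (p1 ∙ sym (br1 a)) ∙ chain (2 * a + 2) ∙ cong f (br2 a ∙ sym p2) ∙ periodic* 2 8))
      where
      p1 : 4 + 2 * L ≡ 4 + 2 * (3 * a + 1)
      p1 = cong (λ x → 4 + 2 * x) e
      p2 : 8 + 2 * L ≡ 8 + 2 * (3 * a + 1)
      p2 = cong (λ x → 8 + 2 * x) e
      br1 : ∀ a → 3 * (2 * a + 2) ≡ 4 + 2 * (3 * a + 1)
      br1 = solve-∀
      br2 : ∀ a → 3 * (2 * a + 2) + 4 ≡ 8 + 2 * (3 * a + 1)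
      br2 = solve-∀
    ... | a , inj₂ (inj₂ e) = ⊥-elim (f4≢f8 (sym (periodic* 1 4) ∙ cong f (p1 ∙ sym (br1 a)) ∙ chain (a + 2) ∙ cong f (br2 a ∙ sym p2) ∙ periodic* 1 8))
      where
      p1 : 4 + 1 * L ≡ 4 + 1 * (3 * a + 2)
      p1 = cong (λ x → 4 + 1 * x) e
      p2 : 8 + 1 * L ≡ 8 + 1 * (3 * a + 2)
      p2 = cong (λ x → 8 + 1 * x) e
      br1 : ∀ a → 3 * (a + 2) ≡ 4 + 1 * (3 * a + 2)
      br1 = solve-∀
      br2 : ∀ a → 3 * (a + 2) + 4 ≡ 8 + 1 * (3 * a + 2)
      br2 = solve-∀

  -- In a chained word of length 3a the chords f (3 j) = f (3 j + 4) pair the positions ≢ 2 (mod 3)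
  -- among themselves, so the letters at the middles M j are paired among themselves.
  module Middles (s : ChordWord G) (10≤L : 10 ≤ ChordWord.L s) (chain : Chained s) (a : ℕ) (L≡3a : ChordWord.L s ≡ 3 * a) where
    open Basic s

    residue-mod3-periodic : ∀ x y r q t u → r < 3 → q < 3 → 3 * x + r + t * L ≡ 3 * y + q + u * L → r ≡ q
    residue-mod3-periodic x y r q t u r3 q3 e = residue-mod3-unique (x + t * a) (y + u * a) r q r3 q3 (ar a x r t ∙ e' ∙ sym (ar a y q u))
      where
      ar : ∀ a x r t → 3 * (x + t * a) + r ≡ 3 * x + r + t * (3 * a)
      ar = solve-∀
      e' : 3 * x + r + t * (3 * a) ≡ 3 * y + q + u * (3 * a)
      e' = subst (λ L' → 3 * x + r + t * L' ≡ 3 * y + q + u * L') L≡3a e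

    4<L : 4 < L
    4<L = ≤-trans (s≤s (s≤s (s≤s (s≤s (s≤s z≤n))))) 10≤L

    f3k≢fM : ∀ k j → f (3 * k) ≡ f (3 * j + 2) → ⊥
    f3k≢fM k j h with reduce-into-window (3 * k) (3 * j + 2)
    ... | q , b≤q , q< , fq , t , u , e with hit-is-one-of (3 * k) 0 4 (q ∸ 3 * k) (s≤s z≤n) 4<L (∸-< b≤q q<)
                                              (cong f (+-identityʳ _) ∙ chain k)
                                              (cong f (m+[n∸m]≡n b≤q) ∙ fq ∙ sym h ∙ cong f (sym (+-identityʳ _)))
    ... | inj₁ e0 with residue-mod3-periodic k j 0 2 t u (s≤s z≤n) (s≤s (s≤s (s≤s z≤n)))
                        (cong (_+ t * L) (sym (sym (m+[n∸m]≡n b≤q) ∙ cong (3 * k +_) e0)) ∙ e)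
    ...   | ()
    f3k≢fM k j h | q , b≤q , q< , fq , t , u , e | inj₂ e4 with residue-mod3-periodic (suc k) j 1 2 t u (s≤s (s≤s z≤n)) (s≤s (s≤s (s≤s z≤n)))
                        (cong (_+ t * L) (ar k ∙ sym (sym (m+[n∸m]≡n b≤q) ∙ cong (3 * k +_) e4)) ∙ e)
      where ar : ∀ k → 3 * suc k + 1 ≡ 3 * k + 4
            ar = solve-∀
    ...   | ()

    a-pos : ∃ λ a' → a ≡ suc a'
    a-pos = aux a L≡3a
      where
      aux : ∀ x → L ≡ 3 * x → ∃ λ a' → x ≡ suc a'
      aux zero e = ⊥-elim (<-irrefl refl (≤-trans (≤-trans (s≤s z≤n) 10≤L) (≤-reflexive e)))
      aux (suc a') _ = a' , refl

    f3k+1≢fM : ∀ k j → f (3 * k + 1) ≡ f (3 * j + 2) → ⊥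
    f3k+1≢fM k j h with a-pos
    ... | a' , ea = f3k≢fM (k + a') j (chain (k + a') ∙ cong f (ar k a' ∙ cong (3 * k + 1 +_) (sym (L≡3a ∙ cong (3 *_) ea))) ∙ periodic (3 * k + 1) ∙ h)
      where ar : ∀ k a' → 3 * (k + a') + 4 ≡ 3 * k + 1 + 3 * suc a'
            ar = solve-∀

    middle-class : ∀ p j → f p ≡ f (M j) → ∃ λ t → p ≡ M t
    middle-class p j h with divmod3 p
    ... | t , inj₁ e = ⊥-elim (f3k≢fM t j (cong f (sym e) ∙ h))
    ... | t , inj₂ (inj₁ e) = ⊥-elim (f3k+1≢fM t j (cong f (sym e) ∙ h))
    ... | t , inj₂ (inj₂ e) = t , e

    chord-from-middle : ∀ j k → f (M j) ≡ f (suc (M j) + k) → ∃ λ g → k ≡ 3 * g + 2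
    chord-from-middle j k h with middle-class (suc (M j) + k) j (sym h) | divmod3 k
    ... | t , et | g , inj₁ e with residue-mod3-periodic (j + g + 1) t 0 2 0 0 (s≤s z≤n) (s≤s (s≤s (s≤s z≤n))) (cong (_+ 0) (ar j g ∙ cong (suc (M j) +_) (sym e) ∙ et))
      where ar : ∀ j g → 3 * (j + g + 1) + 0 ≡ suc (3 * j + 2) + 3 * g
            ar = solve-∀
    ...   | ()
    chord-from-middle j k h | t , et | g , inj₂ (inj₁ e) with residue-mod3-periodic (j + g + 1) t 1 2 0 0 (s≤s (s≤s z≤n)) (s≤s (s≤s (s≤s z≤n))) (cong (_+ 0) (ar j g ∙ cong (suc (M j) +_) (sym e) ∙ et))
      where ar : ∀ j g → 3 * (j + g + 1) + 1 ≡ suc (3 * j + 2) + (3 * g + 1)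
            ar = solve-∀
    ...   | ()
    chord-from-middle j k h | t , et | g , inj₂ (inj₂ e) = g , e

    -- A middle chord with 3g + 2 ≥ 8 letters inside contains four neighbours of its letter once (the
    -- next two middles and the letters at 3 j + 4 and at 3 (j + g + 3)), unless one of those middles
    -- occurs twice inside and so spans a shorter middle chord.
    middle-chord⇒span5 : ∀ fuel j k → k < fuel → f (M j) ≡ f (suc (M j) + k) → suc k < L → ∃ λ i → f (M i) ≡ f (M i + 6)
    middle-chord⇒span5 (suc fuel) j k k<fu h lt with chord-from-middle j k h
    ... | zero , refl with 3≤chord-inside (M j) 2 h lt
    ...   | s≤s (s≤s ())
    middle-chord⇒span5 (suc fuel) j k k<fu h lt | suc zero , refl = j , h ∙ cong f (ar j)
      where ar : ∀ j → suc (3 * j + 2) + 5 ≡ 3 * j + 2 + 6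
            ar = solve-∀
    middle-chord⇒span5 (suc fuel) j k k<fu h lt | suc (suc g') , refl = body
      where
      K = 3 * suc (suc g') + 2
      b = suc (M j)
      C1 = f (M (j + 1))
      C2 = f (M (j + 2))
      A' = f (3 * j + 4)
      B' = f (3 * (j + g' + 3))
      P? = λ z → count f z b K ≟ 1

      K+3≤L : 3 + K ≤ L
      K+3≤L with m≤n⇒m<n∨m≡n lt
      ... | inj₁ h' = subst (_≤ L) (ar g') h'
        where ar : ∀ g' → suc (suc (suc (3 * suc (suc g') + 2))) ≡ 3 + (3 * suc (suc g') + 2)
              ar = solve-∀
      ... | inj₂ e with residue-mod3-periodic (g' + 3) a 1 0 0 0 (s≤s (s≤s z≤n)) (s≤s z≤n) (ar g' ∙ e ∙ L≡3a ∙ sym (+-identityʳ _ ∙ +-identityʳ _))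
        where ar : ∀ g' → 3 * (g' + 3) + 1 + 0 * L ≡ suc (suc (3 * suc (suc g') + 2))
              ar g' = cong (_+ 0) (ar' g') ∙ +-identityʳ _
                where ar' : ∀ g' → 3 * (g' + 3) + 1 ≡ suc (suc (3 * suc (suc g') + 2))
                      ar' = solve-∀
      ...   | ()

      recZ : ∀ j' → 2 ≤ count f (f (M j')) b K → ∃ λ i → f (M i) ≡ f (M i + 6)
      recZ j' hz with 2≤count⇒hit₂ f (f (M j')) b K hz
      ... | i1 , i2 , i1<i2 , i2<K , e1 , e2 with middle-class (b + i1) j' e1
      ...   | t1 , p1 =
        let kk = i2 ∸ suc i1 in
        let pos : suc (b + i1) + kk ≡ b + i2
            pos = cong suc (+-assoc b i1 kk) ∙ sym (+-suc b (i1 + kk)) ∙ cong (b +_) (m+[n∸m]≡n i1<i2) in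
        let kk<K : kk < K
            kk<K = ≤-trans (s≤s (m∸n≤m i2 (suc i1))) i2<K in
        middle-chord⇒span5 fuel t1 kk (≤-trans kk<K (≤-pred k<fu))
          (cong f (sym p1) ∙ e1 ∙ sym e2 ∙ cong f (sym pos) ∙ cong (λ x → f (suc x + kk)) p1)
          (≤-trans (s≤s kk<K) (<⇒≤ lt))

      K≥8 : 8 ≤ K
      K≥8 = subst (8 ≤_) (ar g') (m≤n+m 8 (3 * g'))
        where ar : ∀ g' → 3 * g' + 8 ≡ 3 * suc (suc g') + 2
              ar = solve-∀

      hitb : ∀ i → i < K → ∀ p → b + i ≡ p → 1 ≤ count f (f p) b K
      hitb i i<K p e = hit⇒1≤count f (f p) b K i i<K (cong f e)

      body : ∃ λ i → f (M i) ≡ f (M i + 6)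
      body with 2 ≤? count f C1 b K
      ... | yes hz = recZ (j + 1) hz
      ... | no n1 with 2 ≤? count f C2 b K
      ...   | yes hz = recZ (j + 2) hz
      ...   | no n2 = ⊥-elim (<-irrefl refl (≤-trans (four-distinct⇒4≤# P? A' B' C1 C2 pA pB pC1 pC2 AB AC1 AC2 BC1 BC2 C12)
                                                    (≤-reflexive (#once-inside-chord≡3 (M j) K h lt))))
        where
        r = proj₁ (≤⇒+ K+3≤L)
        Lr : L ≡ 3 + K + r
        Lr = proj₂ (≤⇒+ K+3≤L)
        pC1 : count f C1 b K ≡ 1
        pC1 = 1≤∧≱2⇒≡1 _ (hitb 2 (≤-trans (s≤s (s≤s (s≤s z≤n))) K≥8) (M (j + 1)) (ar j)) n1
          where ar : ∀ j → suc (3 * j + 2) + 2 ≡ 3 * (j + 1) + 2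
                ar = solve-∀
        pC2 : count f C2 b K ≡ 1
        pC2 = 1≤∧≱2⇒≡1 _ (hitb 5 (≤-trans (s≤s (s≤s (s≤s (s≤s (s≤s (s≤s z≤n)))))) K≥8) (M (j + 2)) (ar j)) n2
          where ar : ∀ j → suc (3 * j + 2) + 5 ≡ 3 * (j + 2) + 2
                ar = solve-∀
        pA : count f A' b K ≡ 1
        pA = cong (λ x → count f A' x K) (ar1 j) ∙ once-after-first (3 * j) 2 K r A' Lr (chain j) 1 (≤-trans (s≤s (s≤s z≤n)) K≥8) (cong f (ar2 j))
          where ar1 : ∀ j → suc (3 * j + 2) ≡ 3 * j + 3
                ar1 = solve-∀
                ar2 : ∀ j → 3 * j + 3 + 1 ≡ 3 * j + 4
                ar2 = solve-∀
        pB : count f B' b K ≡ 1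
        pB = once-before-last b K (3 + r) B' (Lr ∙ ar0 K r) (3 * g' + 6) (ar3 g') (cong f (ar1 j g')) 2 (s≤s (s≤s (s≤s z≤n))) (cong f (ar2 j g') ∙ sym (chain (j + g' + 3)))
          where ar0 : ∀ K r → 3 + K + r ≡ K + (3 + r)
                ar0 = solve-∀
                ar1 : ∀ j g' → suc (3 * j + 2) + (3 * g' + 6) ≡ 3 * (j + g' + 3)
                ar1 = solve-∀
                ar2 : ∀ j g' → suc (3 * j + 2) + (3 * suc (suc g') + 2) + 2 ≡ 3 * (j + g' + 3) + 4
                ar2 = solve-∀
                ar3 : ∀ g' → 3 * g' + 6 < 3 * suc (suc g') + 2
                ar3 g' = subst (3 * g' + 6 <_) (ar g') (m≤n+m (suc (3 * g' + 6)) 1)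
                  where ar : ∀ g' → 1 + suc (3 * g' + 6) ≡ 3 * suc (suc g') + 2
                        ar = solve-∀
        AB : A' ≢ B'
        AB e = no-third-hit (3 * j) 0 4 (3 * g' + 9) (s≤s z≤n) (subst (4 <_) (ar1 g') (m≤n+m 5 (3 * g' + 4)))
                 (subst (_< L) (ar2 g') lt)
                 (cong f (+-identityʳ _) ∙ chain j)
                 (cong f (+-identityʳ _) ∙ chain j ∙ e ∙ cong f (ar3 j g'))
          where ar1 : ∀ g' → 3 * g' + 4 + 5 ≡ 3 * g' + 9
                ar1 = solve-∀
                ar2 : ∀ g' → suc (3 * suc (suc g') + 2) ≡ 3 * g' + 9
                ar2 = solve-∀
                ar3 : ∀ j g' → 3 * (j + g' + 3) ≡ 3 * j + (3 * g' + 9)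
                ar3 = solve-∀
        AC1 : A' ≢ C1
        AC1 e = f3k+1≢fM (j + 1) (j + 1) (cong f (ar j) ∙ e)
          where ar : ∀ j → 3 * (j + 1) + 1 ≡ 3 * j + 4
                ar = solve-∀
        AC2 : A' ≢ C2
        AC2 e = f3k+1≢fM (j + 1) (j + 2) (cong f (ar j) ∙ e)
          where ar : ∀ j → 3 * (j + 1) + 1 ≡ 3 * j + 4
                ar = solve-∀
        BC1 : B' ≢ C1
        BC1 e = f3k≢fM (j + g' + 3) (j + 1) e
        BC2 : B' ≢ C2
        BC2 e = f3k≢fM (j + g' + 3) (j + 2) e
        C12 : C1 ≢ C2
        C12 e with 3≤chord-inside (M (j + 1)) 2 (e ∙ cong f (ar j)) (≤-trans (s≤s (s≤s (s≤s (s≤s z≤n)))) 10≤L)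
          where ar : ∀ j → 3 * (j + 2) + 2 ≡ suc (3 * (j + 1) + 2) + 2
                ar = solve-∀
        ... | s≤s (s≤s ())

    degree≡3 : ∀ v → ∑ (λ z → 𝟙 (E-dec G v z)) ≡ 3
    degree≡3 v = sym (length-filter-allFin (E-dec G v)) ∙ cubic v

    -- The window of length k from 2 contains f 2 twice and misses f (2 + k); tracking residues mod 3
    -- shows that only f 0 and f (3 * (3 + h)) occur in it exactly once, so these two would separate G.
    module LongMiddleChord (h : ℕ) (f2≡f8 : f 2 ≡ f 8) (f5≡fM : f 5 ≡ f (M (3 + h))) (long : 3 * h + 15 ≤ L) where
      k = 3 * h + 10
      k≤L : k ≤ L
      k≤L = ≤-trans (+-monoʳ-≤ (3 * h) (s≤s (s≤s (s≤s (s≤s (s≤s (s≤s (s≤s (s≤s (s≤s (s≤s z≤n))))))))))) long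
      6<k : 6 < k
      6<k = ≤-trans (s≤s (s≤s (s≤s (s≤s (s≤s (s≤s (s≤s z≤n))))))) (m≤n+m 10 (3 * h))
      f2-twice : 2 ≤ count f (f 2) 2 k
      f2-twice = hit₂⇒2≤count f (f 2) 2 k 0 6 (s≤s z≤n) 6<k refl (sym f2≡f8)
      twice⇒not-once : ∀ z i j → i < j → j < k → f (2 + i) ≡ z → f (2 + j) ≡ z → count f z 2 k ≡ 1 → ⊥
      twice⇒not-once z i j i<j j<k ei ej e1 = <-irrefl refl (≤-trans (hit₂⇒2≤count f z 2 k i j i<j j<k ei ej) (≤-reflexive e1))
      f[2+k]≡f[6+k] : f (2 + k) ≡ f (2 + (k + 4))
      f[2+k]≡f[6+k] = cong f (ar h) ∙ chain (h + 4) ∙ cong f (ar2 h)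
        where ar : ∀ h → 2 + (3 * h + 10) ≡ 3 * (h + 4)
              ar = solve-∀
              ar2 : ∀ h → 3 * (h + 4) + 4 ≡ 2 + (3 * h + 10 + 4)
              ar2 = solve-∀
      f[2+k]-absent : count f (f (2 + k)) 2 k ≡ 0
      f[2+k]-absent with count f (f (2 + k)) 2 k in eq
      ... | zero = refl
      ... | suc _ with 1≤count⇒hit f (f (2 + k)) 2 k (≤-trans (s≤s z≤n) (≤-reflexive (sym eq)))
      ...   | r , r<k , er = ⊥-elim (no-third-hit 2 r k (k + 4) r<k (m<m+n k (s≤s z≤n))
                 (≤-trans (≤-reflexive (ar h)) long) (er) (er ∙ f[2+k]≡f[6+k]))
        where ar : ∀ h → suc (3 * h + 10 + 4) ≡ 3 * h + 15
              ar = solve-∀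
      f2-not-once : count f (f 2) 2 k ≡ 1 → ⊥
      f2-not-once e = <-irrefl refl (≤-trans f2-twice (≤-reflexive e))
      kd = 3 * h + 5
      M[3+h]≡6+kd : M (3 + h) ≡ suc 5 + kd
      M[3+h]≡6+kd = ar h
        where ar : ∀ h → 3 * (3 + h) + 2 ≡ suc 5 + (3 * h + 5)
              ar = solve-∀
      f5-not-once : count f (f 5) 2 k ≡ 1 → ⊥
      f5-not-once e = twice⇒not-once (f 5) 3 (3 * h + 9) (≤-trans (s≤s (s≤s (s≤s (s≤s z≤n)))) (m≤n+m 9 (3 * h))) (subst (3 * h + 9 <_) (ar h) (m<m+n (3 * h + 9) (s≤s z≤n)))
               refl (cong f (ar2 h) ∙ sym f5≡fM) e
        where ar : ∀ h → 3 * h + 9 + 1 ≡ 3 * h + 10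
              ar = solve-∀
              ar2 : ∀ h → 2 + (3 * h + 9) ≡ 3 * (3 + h) + 2
              ar2 = solve-∀
      count-inner≤ : ∀ z → count f z 6 kd ≤ count f z 2 k
      count-inner≤ z = ≤-trans (m≤n+m _ (count f z 2 4)) (≤-trans (m≤m+n _ (count f z (6 + kd) 1))
                 (≤-reflexive (sym (count-+ f z 2 (4 + kd) 1 ∙ cong (_+ count f z (6 + kd) 1) (count-+ f z 2 4 kd)) ∙ cong (count f z 2) (ar h))))
        where ar : ∀ h → 4 + (3 * h + 5) + 1 ≡ 3 * h + 10
              ar = solve-∀
      f5-chord : f 5 ≡ f (suc 5 + kd)
      f5-chord = f5≡fM ∙ cong f M[3+h]≡6+kd
      f5-chord<L : suc kd < L
      f5-chord<L = ≤-trans (≤-reflexive (ar h)) (≤-trans (m≤m+n (3 * h + 7) 8) (≤-trans (≤-reflexive (ar2 h)) long))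
        where ar : ∀ h → suc (suc (3 * h + 5)) ≡ 3 * h + 7
              ar = solve-∀
              ar2 : ∀ h → 3 * h + 7 + 8 ≡ 3 * h + 15
              ar2 = solve-∀
      once-inner⇒f5~ : ∀ w → count f w 6 kd ≡ 1 → E G (f 5) w
      once-inner⇒f5~ w = Equivalence.from (chord-adj 5 kd w f5-chord f5-chord<L)
      fB = f (3 * (3 + h))
      le1 : 4 + kd ≤ L
      le1 = ≤-trans (≤-reflexive (ar h)) (≤-trans (m≤m+n (3 * h + 9) 6) (≤-trans (≤-reflexive (ar2 h)) long))
        where ar : ∀ h → 4 + (3 * h + 5) ≡ 3 * h + 9
              ar = solve-∀
              ar2 : ∀ h → 3 * h + 9 + 6 ≡ 3 * h + 15
              ar2 = solve-∀
      kd≥5 : 5 ≤ kd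
      kd≥5 = m≤n+m 5 (3 * h)
      f5~f2 : E G (f 5) (f 2)
      f5~f2 = once-inner⇒f5~ (f 2) (once-after-first 2 3 kd (proj₁ (≤⇒+ le1)) (f 2) (proj₂ (≤⇒+ le1)) refl 2 (≤-trans (s≤s (s≤s (s≤s z≤n))) kd≥5) (sym f2≡f8))
      f5~f3 : E G (f 5) (f 3)
      f5~f3 = once-inner⇒f5~ (f 3) (once-after-first 3 2 kd (suc (proj₁ (≤⇒+ le1))) (f 3) (proj₂ (≤⇒+ le1) ∙ ar kd _) refl 1 (≤-trans (s≤s (s≤s z≤n)) kd≥5) (sym (chain 1)))
        where ar : ∀ kd r → 4 + kd + r ≡ 3 + kd + suc r
              ar = solve-∀
      f5~fB : E G (f 5) fB
      f5~fB = once-inner⇒f5~ fB (once-before-last 6 kd (4 + proj₁ (≤⇒+ le1)) fB (proj₂ (≤⇒+ le1) ∙ ar kd _) (3 * h + 3) (subst (3 * h + 3 <_) (ar2 h) (m<m+n (3 * h + 3) (s≤s z≤n)))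
              (cong f (ar3 h)) 2 (s≤s (s≤s (s≤s z≤n))) (cong f (ar4 h) ∙ sym (chain (3 + h))))
        where ar : ∀ kd r → 4 + kd + r ≡ kd + (4 + r)
              ar = solve-∀
              ar2 : ∀ h → 3 * h + 3 + 2 ≡ 3 * h + 5
              ar2 = solve-∀
              ar3 : ∀ h → 6 + (3 * h + 3) ≡ 3 * (3 + h)
              ar3 = solve-∀
              ar4 : ∀ h → 6 + (3 * h + 5) + 2 ≡ 3 * (3 + h) + 4
              ar4 = solve-∀
      f2≢f3 : f 2 ≢ f 3
      f2≢f3 e = f3k≢fM 1 0 (sym e)
      f2≢fB : f 2 ≢ fB
      f2≢fB e = f3k≢fM (3 + h) 0 (sym e)
      f3≢fB : f 3 ≢ fB
      f3≢fB e = no-third-hit 3 0 4 (3 * h + 6) (s≤s z≤n) (≤-trans (s≤s (s≤s (s≤s (s≤s (s≤s z≤n))))) (m≤n+m 6 (3 * h)))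
                (≤-trans (≤-reflexive (ar h)) (≤-trans (m≤m+n (3 * h + 7) 8) (≤-trans (≤-reflexive (ar2 h)) long)))
                (chain 1) (chain 1 ∙ sym (chain 1) ∙ e ∙ cong f (ar3 h))
        where ar : ∀ h → suc (3 * h + 6) ≡ 3 * h + 7
              ar = solve-∀
              ar2 : ∀ h → 3 * h + 7 + 8 ≡ 3 * h + 15
              ar2 = solve-∀
              ar3 : ∀ h → 3 * (3 + h) ≡ 3 + (3 * h + 6)
              ar3 = solve-∀
      inner-middle-not-once : ∀ t3 → t3 < h → count f (f (M (t3 + 3))) 2 k ≡ 1 → ⊥
      inner-middle-not-once t3 t3<h pz =
        fin (#≡3⇒one-of-three (E-dec G (f 5)) (degree≡3 (f 5)) (f 2) (f 3) fB f5~f2 f5~f3 f5~fB f2≢f3 f2≢fB f3≢fB z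
               (once-inner⇒f5~ z Ez))
        where
        z = f (M (t3 + 3))
        Ez : count f z 6 kd ≡ 1
        Ez = ≤-antisym (≤-trans (count-inner≤ z) (≤-reflexive pz))
               (hit⇒1≤count f z 6 kd (3 * t3 + 5) (≤-trans (≤-reflexive (ar t3)) (≤-trans (+-monoˡ-≤ 3 (*-monoʳ-≤ 3 t3<h)) (+-monoʳ-≤ (3 * h) (s≤s (s≤s (s≤s z≤n))))))
                 (cong f (ar3 t3)))
          where ar : ∀ t3 → suc (3 * t3 + 5) ≡ 3 * suc t3 + 3
                ar = solve-∀
                ar3 : ∀ t3 → 6 + (3 * t3 + 5) ≡ 3 * (t3 + 3) + 2
                ar3 = solve-∀
        fin : z ≡ f 2 ⊎ z ≡ f 3 ⊎ z ≡ fB → ⊥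
        fin (inj₁ e) = f2-not-once (subst (λ w → count f w 2 k ≡ 1) e pz)
        fin (inj₂ (inj₁ e)) = f3k≢fM 1 (t3 + 3) (sym e)
        fin (inj₂ (inj₂ e)) = f3k≢fM (3 + h) (t3 + 3) (sym e)

      module OnceLetter (z : Fin n) (pz : count f z 2 k ≡ 1) (r : ℕ) (r<k : r < k) (ez : f (2 + r) ≡ z) where
        residue0 : ∀ t → 2 + r ≡ 3 * t → z ≡ f 0 ⊎ z ≡ fB
        residue0 t e with <-cmp t (h + 3)
        ... | tri< t<h3 _ _ = ⊥-elim (twice⇒not-once z r (3 * t + 2) r<3t2 3t2<k ez ez2 pz)
          where
          r<3t2 : r < 3 * t + 2
          r<3t2 = ≤-trans (s≤s (n≤1+n r)) (≤-trans (≤-reflexive e) (m≤m+n (3 * t) 2))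
          ar : ∀ t → suc (3 * t + 2) ≡ 3 * suc t
          ar = solve-∀
          ar2 : ∀ h → 3 * (h + 3) + 1 ≡ 3 * h + 10
          ar2 = solve-∀
          3t2<k : 3 * t + 2 < k
          3t2<k = ≤-trans (≤-reflexive (ar t)) (≤-trans (*-monoʳ-≤ 3 t<h3) (≤-trans (m≤m+n _ 1) (≤-reflexive (ar2 h))))
          ar3 : ∀ t → 2 + (3 * t + 2) ≡ 3 * t + 4
          ar3 = solve-∀
          ez2 : f (2 + (3 * t + 2)) ≡ z
          ez2 = cong f (ar3 t) ∙ sym (chain t) ∙ cong f (sym e) ∙ ez
        ... | tri≈ _ t≡ _ = inj₂ (sym ez ∙ cong f (e ∙ cong (3 *_) (t≡ ∙ +-comm h 3)))
        ... | tri> _ _ h3<t = ⊥-elim (<-irrefl e (≤-trans (+-monoʳ-< 2 r<k) (≤-trans (≤-reflexive (ar4 h)) (*-monoʳ-≤ 3 h3<t))))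
          where
          ar4 : ∀ h → 2 + (3 * h + 10) ≡ 3 * suc (h + 3)
          ar4 = solve-∀
        residue1 : ∀ t → 2 + r ≡ 3 * t + 1 → z ≡ f 0 ⊎ z ≡ fB
        residue1 zero ()
        residue1 (suc zero) e = inj₁ (sym ez ∙ cong f e ∙ sym (chain 0))
        residue1 (suc (suc t'')) e = ⊥-elim (twice⇒not-once z (3 * t'' + 1) r lt r<k e1 ez pz)
          where
          ar : ∀ t'' → 3 * suc (suc t'') + 1 ≡ 2 + (3 * t'' + 5)
          ar = solve-∀
          ri : r ≡ 3 * t'' + 5
          ri = +-cancelˡ-≡ 2 _ _ (e ∙ ar t'')
          lt : 3 * t'' + 1 < r
          lt = subst (3 * t'' + 1 <_) (sym ri) (≤-trans (m≤m+n (suc (3 * t'' + 1)) 3) (≤-reflexive (ar2 t'')))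
            where ar2 : ∀ t'' → suc (3 * t'' + 1) + 3 ≡ 3 * t'' + 5
                  ar2 = solve-∀
          ar5 : ∀ t'' → 2 + (3 * t'' + 1) ≡ 3 * suc t''
          ar5 = solve-∀
          ar6 : ∀ t'' → 3 * suc t'' + 4 ≡ 3 * suc (suc t'') + 1
          ar6 = solve-∀
          e1 : f (2 + (3 * t'' + 1)) ≡ z
          e1 = cong f (ar5 t'') ∙ chain (suc t'') ∙ cong f (ar6 t'' ∙ sym e) ∙ ez
        residue2 : ∀ t → 2 + r ≡ 3 * t + 2 → z ≡ f 0 ⊎ z ≡ fB
        residue2 t e = ⊥-elim (go t (sym ez ∙ cong f e) (+-cancelˡ-≡ 2 _ _ (e ∙ +-comm (3 * t) 2)))
          where
          go : ∀ t → z ≡ f (3 * t + 2) → r ≡ 3 * t → ⊥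
          go zero ez' _ = f2-not-once (subst (λ w → count f w 2 k ≡ 1) ez' pz)
          go (suc zero) ez' _ = f5-not-once (subst (λ w → count f w 2 k ≡ 1) ez' pz)
          go (suc (suc zero)) ez' _ = f2-not-once (subst (λ w → count f w 2 k ≡ 1) (ez' ∙ sym f2≡f8) pz)
          go (suc (suc (suc t3))) ez' rt with <-cmp t3 h
          ... | tri< t3<h _ _ = inner-middle-not-once t3 t3<h (subst (λ w → count f w 2 k ≡ 1) (ez' ∙ cong (λ x → f (3 * x + 2)) (+-comm 3 t3)) pz)
          ... | tri≈ _ t3≡h _ = f5-not-once (subst (λ w → count f w 2 k ≡ 1) (ez' ∙ cong (λ x → f (3 * x + 2)) (cong (3 +_) t3≡h) ∙ sym f5≡fM) pz)
          ... | tri> _ _ h<t3 = <-irrefl refl (≤-trans r<k (≤-trans (≤-reflexive (ar h)) (≤-trans (+-monoˡ-≤ 7 (*-monoʳ-≤ 3 h<t3)) (≤-trans (+-monoʳ-≤ (3 * t3) (s≤s (s≤s (s≤s (s≤s (s≤s (s≤s (s≤s z≤n)))))))) (≤-reflexive (sym (rt ∙ ar2 t3)))))))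
            where
            ar : ∀ h → 3 * h + 10 ≡ 3 * suc h + 7
            ar = solve-∀
            ar2 : ∀ t3 → 3 * suc (suc (suc t3)) ≡ 3 * t3 + 9
            ar2 = solve-∀

      once⇒f0-or-fB : ∀ z → count f z 2 k ≡ 1 → z ≡ f 0 ⊎ z ≡ fB
      once⇒f0-or-fB z pz = let (r , r<k , ez) = 1≤count⇒hit f z 2 k (≤-reflexive (sym pz)) in dispatch r r<k ez (divmod3 (2 + r))
        where
        dispatch : ∀ r → r < k → f (2 + r) ≡ z → (∃ λ t → 2 + r ≡ 3 * t ⊎ 2 + r ≡ 3 * t + 1 ⊎ 2 + r ≡ 3 * t + 2) → z ≡ f 0 ⊎ z ≡ fB
        dispatch r r<k ez (t , inj₁ e) = OnceLetter.residue0 z pz r r<k ez t e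
        dispatch r r<k ez (t , inj₂ (inj₁ e)) = OnceLetter.residue1 z pz r r<k ez t e
        dispatch r r<k ez (t , inj₂ (inj₂ e)) = OnceLetter.residue2 z pz r r<k ez t e

      #once≤2 : #once f 2 k ≤ 2
      #once≤2 = one-of-two⇒#≤2 (λ z → count f z 2 k ≟ 1) (f 0) fB once⇒f0-or-fB

      contradiction : ⊥
      contradiction = no-small-cut 2 k k≤L (f 2) (f (2 + k)) f2-twice f[2+k]-absent #once≤2

    no-long-middle-chord : ∀ h → f 2 ≡ f 8 → f 5 ≡ f (M (3 + h)) → 3 * h + 15 ≤ L → ⊥
    no-long-middle-chord h f2≡f8 f5≡fM long = LongMiddleChord.contradiction h f2≡f8 f5≡fM long

    middle-chord-span5 : ∃ λ i → f (M i) ≡ f (M i + 6)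
    middle-chord-span5 with second-hit (M 0)
    ... | k , lt , e = middle-chord⇒span5 (suc k) 0 k ≤-refl (sym e) lt

  module LengthTwelve (s : ChordWord G) (10≤L : 10 ≤ ChordWord.L s) (chain : Chained s) (a : ℕ) (L≡3a : ChordWord.L s ≡ 3 * a)
                      (f2≡f8 : ChordWord.f s 2 ≡ ChordWord.f s 8) where
    open Basic s
    open Middles s 10≤L chain a L≡3a

    -- f 5 is paired with a middle M (3 + h): with a = h + 4 and h > 0 the chord read from its far end is
    -- a long middle chord of a rotation, and every other position of the partner is excluded directly.
    twelve : a ≡ 4 × f 5 ≡ f 11
    twelve with second-hit 5
    ... | k , lt , e with middle-class (6 + k) 1 e
    ... | t , et = go t (sym e ∙ cong f et) (subst (_< 5 + L) et (+-monoʳ-< 5 lt)) (subst (6 ≤_) et (m≤m+n 6 k))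
      where
      cd : f 2 ≢ f 5
      cd e' = no-third-hit 0 2 5 8 (s≤s (s≤s (s≤s z≤n))) (s≤s (s≤s (s≤s (s≤s (s≤s (s≤s z≤n))))))
                (≤-trans (s≤s (s≤s (s≤s (s≤s (s≤s (s≤s (s≤s (s≤s (s≤s z≤n))))))))) 10≤L) e' f2≡f8
      go : ∀ t → f 5 ≡ f (M t) → M t < 5 + L → 6 ≤ M t → a ≡ 4 × f 5 ≡ f 11
      go zero e' _ (s≤s (s≤s ()))
      go (suc zero) e' _ (s≤s (s≤s (s≤s (s≤s (s≤s ())))))
      go (suc (suc zero)) e' _ _ = ⊥-elim (cd (f2≡f8 ∙ sym e'))
      go (suc (suc (suc h))) e' lt' _ with <-cmp a (h + 4)
      ... | tri< a<h4 _ _ =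
        let lo : h + 3 ≤ a
            lo = subst (_≤ a) (sym (+-suc h 2)) (*-cancelˡ-< 3 _ _ (≤-trans (≤-reflexive (ar1 h)) (≤-trans (+-cancelˡ-≤ 5 _ _ (≤-trans (≤-reflexive (ar0 h)) lt')) (≤-reflexive L≡3a)))) in
        let a≡ : a ≡ h + 3
            a≡ = ≤-antisym (≤-pred (subst (a <_) (+-suc h 3) a<h4)) lo in
        ⊥-elim (cd (sym (periodic 2) ∙ cong f (cong (2 +_) (L≡3a ∙ cong (3 *_) a≡) ∙ ar2 h) ∙ sym e'))
        where
        ar0 : ∀ h → 5 + (3 * h + 7) ≡ suc (3 * (3 + h) + 2)
        ar0 = solve-∀
        ar1 : ∀ h → suc (3 * (h + 2)) ≡ 3 * h + 7
        ar1 = solve-∀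
        ar2 : ∀ h → 2 + 3 * (h + 3) ≡ 3 * (3 + h) + 2
        ar2 = solve-∀
      ... | tri> _ _ h4<a = ⊥-elim (no-long-middle-chord h f2≡f8 e' (≤-trans (≤-reflexive (ar h)) (≤-trans (*-monoʳ-≤ 3 h4<a) (≤-reflexive (sym L≡3a)))))
        where
        ar : ∀ h → 3 * h + 15 ≡ 3 * suc (h + 4)
        ar = solve-∀
      ... | tri≈ _ a≡ _ = second h a≡ e'
        where
        second : ∀ h → a ≡ h + 4 → f 5 ≡ f (M (3 + h)) → a ≡ 4 × f 5 ≡ f 11
        second zero a≡ e' = a≡ , e'
        second (suc h') a≡ e' = ⊥-elim (Middles.no-long-middle-chord s′ 10≤L chained′ a L≡3a 0 f2≡f8′ f5≡fM′ L15)
          where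
          hh = suc h'
          w = 3 * (3 + hh)
          s′ = rotate s w
          chained′ = chain-rotate s chain (3 + hh)
          Lh : L ≡ 3 * hh + 12
          Lh = L≡3a ∙ cong (3 *_) a≡ ∙ ar hh
            where ar : ∀ hh → 3 * (hh + 4) ≡ 3 * hh + 12
                  ar = solve-∀
          f2≡f8′ : f (w + 2) ≡ f (w + 8)
          f2≡f8′ = sym e' ∙ sym (periodic 5) ∙ cong f (cong (5 +_) Lh ∙ ar hh)
            where ar : ∀ hh → 5 + (3 * hh + 12) ≡ 3 * (3 + hh) + 8
                  ar = solve-∀
          f5≡fM′ : f (w + 5) ≡ f (w + M (3 + 0))
          f5≡fM′ = cong f (ar1 hh ∙ cong (2 +_) (sym Lh)) ∙ periodic 2 ∙ f2≡f8 ∙ sym (periodic 8) ∙ cong f (cong (8 +_) Lh ∙ ar2 hh)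
            where ar1 : ∀ hh → 3 * (3 + hh) + 5 ≡ 2 + (3 * hh + 12)
                  ar1 = solve-∀
                  ar2 : ∀ hh → 8 + (3 * hh + 12) ≡ 3 * (3 + hh) + 11
                  ar2 = solve-∀
          L15 : 3 * 0 + 15 ≤ L
          L15 = ≤-trans (m≤n+m 15 (3 * h')) (≤-reflexive (ar h' ∙ sym Lh))
            where ar : ∀ h' → 3 * h' + 15 ≡ 3 * suc h' + 12
                  ar = solve-∀

  ≅K33 : ChordWord G → 5 ≤ n → IsoTo G 6 K33-adj
  ≅K33 s₀ 5≤n = K33Word.≅K33 s₂ L₂≡12 chained₂ f2≡f8 (proj₂ (LengthTwelve.twelve s₂ 10≤L chained₂ a L≡3a f2≡f8))
    where
    10≤L : 10 ≤ ChordWord.L s₀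
    10≤L = ≤-trans (*-monoˡ-≤ 2 5≤n) (≤-reflexive (sym (ChordWordFacts.L≡2n s₀)))
    w = proj₁ (Basic.span3-chord s₀)
    s₁ = rotate s₀ w
    chained₁ : Chained s₁
    chained₁ = chained s₁ 10≤L (cong (ChordWord.f s₀) (+-identityʳ w) ∙ proj₂ (Basic.span3-chord s₀))
    a = proj₁ (ThreeDividesLength.3∣L s₁ 10≤L chained₁)
    L≡3a = proj₂ (ThreeDividesLength.3∣L s₁ 10≤L chained₁)
    i = proj₁ (Middles.middle-chord-span5 s₁ 10≤L chained₁ a L≡3a)
    s₂ = rotate s₁ (3 * i)
    chained₂ = chain-rotate s₁ chained₁ i
    f2≡f8 : ChordWord.f s₂ 2 ≡ ChordWord.f s₂ 8
    f2≡f8 = proj₂ (Middles.middle-chord-span5 s₁ 10≤L chained₁ a L≡3a) ∙ cong (ChordWord.f s₁) (+-assoc (3 * i) 2 6)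
    L₂≡12 : ChordWord.L s₂ ≡ 12
    L₂≡12 = L≡3a ∙ cong (3 *_) (proj₁ (LengthTwelve.twelve s₂ 10≤L chained₂ a L≡3a f2≡f8))

cubic-on-four≅K4 : ∀ (G : Graph 4) → Regular 3 G → IsoTo G 4 K4-adj
cubic-on-four≅K4 G cubic = mk↔ₛ′ (λ x → x) (λ x → x) (λ _ → refl) (λ _ → refl) , λ u v → mk⇔ (adjacent⇒≢ u v) (≢⇒adjacent u v)
  where
  adjacent⇒≢ : ∀ u v → E G u v → u ≢ v
  adjacent⇒≢ u v e refl = E-irrefl G e
  ≢⇒adjacent : ∀ u v → u ≢ v → E G u v
  ≢⇒adjacent u v u≢v with E-dec G u v
  ... | yes e = e
  ... | no ¬e = ⊥-elim (<-irrefl refl (≤-trans (≤-reflexive (cong (_+ 2) degree≡3)) degree+2≤4))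
    where
    degree≡3 : 3 ≡ ∑ (λ w → 𝟙 (E-dec G u w))
    degree≡3 = sym (sym (length-filter-allFin (E-dec G u)) ∙ cubic u)
    pointwise : ∀ w → 𝟙 (E-dec G u w) + (𝟙 (u ≟F w) + 𝟙 (v ≟F w)) ≤ 1
    pointwise w with E-dec G u w | u ≟F w | v ≟F w
    ... | yes e | yes refl | _ = ⊥-elim (E-irrefl G e)
    ... | yes e | no _ | yes refl = ⊥-elim (¬e e)
    ... | yes e | no _ | no _ = s≤s z≤n
    ... | no _ | yes refl | yes refl = ⊥-elim (u≢v refl)
    ... | no _ | yes _ | no _ = s≤s z≤n
    ... | no _ | no _ | yes _ = s≤s z≤n
    ... | no _ | no _ | no _ = z≤n
    degree+2≤4 : ∑ (λ w → 𝟙 (E-dec G u w)) + 2 ≤ 4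
    degree+2≤4 =
      ≤-trans (≤-reflexive (cong (∑ (λ w → 𝟙 (E-dec G u w)) +_)
                                 (sym (∑-+ (λ w → 𝟙 (u ≟F w)) (λ w → 𝟙 (v ≟F w)) ∙ cong₂ _+_ (∑-𝟙-singleton u) (∑-𝟙-singleton v)))
                           ∙ sym (∑-+ (λ w → 𝟙 (E-dec G u w)) (λ w → 𝟙 (u ≟F w) + 𝟙 (v ≟F w)))))
              (≤-trans (∑-mono-≤ pointwise) (≤-reflexive (∑-const 4 1)))

corollary7 : ∀ (n : ℕ) (G : Graph n) →
    Regular 3 G → CircleGraph G →
    ¬ IsoTo G 4 K4-adj → ¬ IsoTo G 6 K33-adj →
    ¬ Connected-k 3 G
corollary7 n G cubic circle ¬K4 ¬K33 (3<n , conn) with n ≟ 4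
... | yes refl = ¬K4 (cubic-on-four≅K4 G cubic)
... | no n≢4 = ¬K33 (Cubic3Connected.≅K33 G cubic conn word 5≤n)
  where
  word = circle⇒chordWord G (<-trans (s≤s z≤n) 3<n) circle
  5≤n = ≤∧≢⇒< 3<n (n≢4 ∘ sym)
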